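{- For every integer $n\geq 0$, $$\sum_{T\in\mathcal{LB}_{2n+1}}(-1)^{\mathsf{h}(T)}=\sum_{k=0}^n (-1)^k\,O(2n+1,2k+1)\,2^{2n-2k}\,C_k .$$
   Context: For a positive integer $m$, a set composition of $[m]=\{1,\dots,m\}$ is an ordered list $\phi_1/\phi_2/\cdots/\phi_\ell$ of pairwise disjoint nonempty subsets (blocks) of $[m]$ whose union is $[m]$; it is odd if every block has an odd number of elements. $O(m,k)$ denotes the number of odd set compositions of $[m]$ with exactly $k$ blocks. $C_k=\frac{1}{k+1}\binom{2k}{k}$ is the $k$-th Catalan number. A word $w=w_1\cdots w_j$ with distinct letters is unimodal if $w_1<\cdots<w_m>w_{m+1}>\cdots>w_j$ for some $1\le m\le j$; it is an odd unimodal permutation if moreover $j$ is odd. A complete binary tree is a rooted (plane) tree in which every internal node has a left child and a right child. A labeled binary tree on $[2n+1]$ is a complete binary tree whose nodes are labeled by odd unimodal permutations such that the sets of letters of all labels form a set partition of $[2n+1]$. $\mathcal{LB}_{2n+1}$ is the set of all labeled binary trees on $[2n+1]$, and for $T\in\mathcal{LB}_{2n+1}$, $\mathsf{h}(T)$ is half the number of edges of $T$. -}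

module Defs where

open import Data.Nat using (ℕ; zero; suc; _+_; _*_; _∸_; _<_; _>_)
open import Data.Nat.DivMod using (_/_; _%_)
open import Data.Nat.Combinatorics using (_C_)
open import Data.Integer as ℤ using (ℤ; +_; -_)
open import Data.Fin using (Fin)
open import Data.Fin.Subset using (Subset; ∣_∣; _∩_; ⋃; ⊤) renaming (⊥ to ∅)
open import Data.List using (List; []; _∷_; _++_; [_]; length; concat; map; upTo)
open import Data.List.Relation.Unary.All using (All)
open import Data.List.Relation.Unary.Linked using (Linked)
open import Data.List.Relation.Binary.Permutation.Propositional using (_↭_)
open import Data.Vec using (Vec; lookup; toList)
open import Data.Product using (Σ; _×_)
open import Relation.Binary.PropositionalEquality using (_≡_; _≢_)

range : ℕ → List ℕ
range m = map suc (upTo m)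

∑ : (E : ℕ) → (Fin E → ℤ) → ℤ
∑ zero f = + 0
∑ (suc E) f = f Fin.zero ℤ.+ ∑ E (λ i → f (Fin.suc i))
  where import Data.Fin as Fin

∑≤ : ℕ → (ℕ → ℤ) → ℤ
∑≤ zero f = f 0
∑≤ (suc n) f = ∑≤ n f ℤ.+ f (suc n)

catalan : ℕ → ℕ
catalan k = ((2 * k) C k) / suc k

Word : Set
Word = List ℕ

Unimodal : Word → Set
Unimodal w = Σ (List ℕ) λ as → Σ ℕ λ p → Σ (List ℕ) λ ds →
  (w ≡ as ++ p ∷ ds) × Linked _<_ (as ++ [ p ]) × Linked _>_ (p ∷ ds)

OddUnimodal : Word → Set
OddUnimodal w = Unimodal w × (length w % 2 ≡ 1)

data Tree : Set where
  leaf : Word → Tree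
  node : Word → Tree → Tree → Tree

labels : Tree → List Word
labels (leaf w) = [ w ]
labels (node w l r) = w ∷ labels l ++ labels r

edges : Tree → ℕ
edges (leaf _) = 0
edges (node _ l r) = 2 + edges l + edges r

h : Tree → ℕ
h T = edges T / 2

-- Labeled binary trees on [m]: all labels odd unimodal permutations and
-- the letter sets of the labels form a set partition of [m]
-- (labels have distinct letters, so this is: concatenation of labels is a
-- permutation of 1..m).
record LB (m : ℕ) : Set where
  constructor lb
  field
    tree : Tree
    .labelsOddUnimodal : All OddUnimodal (labels tree)
    .partition : concat (labels tree) ↭ range m

sign : ℕ → ℤ
sign k = (- (+ 1)) ℤ.^ k

-- Odd set compositions of [m] with k blocks (blocks are subsets of Fin m,
-- element i of Fin m standing for i+1)

record OddComp (m k : ℕ) : Set where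
  constructor oc
  field
    blocks : Vec (Subset m) k
    .oddBlocks : (i : Fin k) → ∣ lookup blocks i ∣ % 2 ≡ 1
    .disjoint : (i j : Fin k) → i ≢ j → lookup blocks i ∩ lookup blocks j ≡ ∅
    .covering : ⋃ (toList blocks) ≡ ⊤

{-# OPTIONS --safe #-}
module Submission where

-- Every tree with k internal nodes has sign (-1)^k, so it suffices to count, for each k ≤ n,
-- the trees with k internal nodes. Such a tree is a shape (a complete binary tree with k
-- internal nodes; there are C_k of them, by Rémy's bijection between shapes with k+1 internal
-- nodes and a marked leaf and shapes with k internal nodes, a marked node and a side) together
-- with its 2k+1 labels in preorder. An odd unimodal word is determined by its letter set S and
-- the set of letters after its peak, an arbitrary subset of S minus its maximum. Hence the label
-- vectors correspond to odd set compositions of [2n+1] into 2k+1 blocks, each with 2^(2n-2k)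
-- choices of descents.

module Enumerations where

  open import Defs using (∑)
  open import Data.Nat using (ℕ; zero; suc; _+_; _*_)
  open import Data.Integer using (ℤ; +_) renaming (_+_ to _+ℤ_; _*_ to _*ℤ_)
  import Data.Integer.Properties as ℤ
  open import Data.Fin using (Fin; zero; suc; _↑ˡ_; _↑ʳ_)
  open import Data.Fin.Properties using (0↔⊥; 1↔⊤; 2↔Bool; +↔⊎; splitAt-↑ˡ; splitAt-↑ʳ)
  open import Data.Bool using (Bool)
  open import Data.Empty using (⊥)
  open import Data.Unit using (⊤)
  open import Data.Product using (Σ; _×_; _,_)
  open import Data.Product.Function.Dependent.Propositional using (Σ-↔)
  open import Data.Sum using (_⊎_; inj₁; inj₂)
  open import Data.Sum.Function.Propositional using (_⊎-↔_)
  open import Function using (_∘_; const; _↔_; Inverse; mk↔ₛ′)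
  open import Function.Properties.Inverse using (↔-refl; ↔-sym; ↔-trans)
  open import Relation.Binary.PropositionalEquality
    using (_≡_; _≗_; refl; sym; trans; cong; cong₂; module ≡-Reasoning)
  import Algebra.Properties.CommutativeMonoid.Sum ℤ.+-0-commutativeMonoid as ℤSum

  private variable
    A B : Set
    N : ℕ

  record Enumeration (A : Set) : Set where
    constructor enumeration
    field
      size  : ℕ
      index : Fin size ↔ A
  open Enumeration public

  sumOver : Enumeration A → (A → ℤ) → ℤ
  sumOver E f = ∑ (size E) (f ∘ Inverse.to (index E))

  ∑-cong : ∀ N {f g : Fin N → ℤ} → f ≗ g → ∑ N f ≡ ∑ N g
  ∑-cong zero    f≗g = refl
  ∑-cong (suc N) f≗g = cong₂ _+ℤ_ (f≗g zero) (∑-cong N (f≗g ∘ suc))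

  ∑≡sum : ∀ N (f : Fin N → ℤ) → ∑ N f ≡ ℤSum.sum f
  ∑≡sum zero    f = refl
  ∑≡sum (suc N) f = cong (f zero +ℤ_) (∑≡sum N (f ∘ suc))

  ∑-permute : ∀ {M N} (π : Fin M ↔ Fin N) (f : Fin N → ℤ) → ∑ M (f ∘ Inverse.to π) ≡ ∑ N f
  ∑-permute {M} {N} π f = begin
    ∑ M (f ∘ Inverse.to π)        ≡⟨ ∑≡sum M _ ⟩
    ℤSum.sum (f ∘ Inverse.to π)   ≡⟨ ℤSum.sum-permute f π ⟨
    ℤSum.sum f                    ≡⟨ ∑≡sum N f ⟨
    ∑ N f                         ∎
    where open ≡-Reasoning

  ∑-const : ∀ N c → ∑ N (const c) ≡ + N *ℤ c
  ∑-const zero    c = sym (ℤ.*-zeroˡ c)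
  ∑-const (suc N) c = begin
    c +ℤ ∑ N (const c)   ≡⟨ cong (c +ℤ_) (∑-const N c) ⟩
    c +ℤ + N *ℤ c        ≡⟨ sym (ℤ.suc-* (+ N) c) ⟩
    + suc N *ℤ c         ∎
    where open ≡-Reasoning

  ∑-+ : ∀ M N (f : Fin (M + N) → ℤ) → ∑ (M + N) f ≡ ∑ M (f ∘ (_↑ˡ N)) +ℤ ∑ N (f ∘ (M ↑ʳ_))
  ∑-+ zero    N f = sym (ℤ.+-identityˡ _)
  ∑-+ (suc M) N f = trans (cong (f zero +ℤ_) (∑-+ M N (f ∘ suc))) (sym (ℤ.+-assoc (f zero) _ _))

  sumOver-cong : (E : Enumeration A) {f g : A → ℤ} → f ≗ g → sumOver E f ≡ sumOver E g
  sumOver-cong E f≗g = ∑-cong (size E) (f≗g ∘ Inverse.to (index E))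

  sumOver-unique : (E E′ : Enumeration A) (f : A → ℤ) → sumOver E f ≡ sumOver E′ f
  sumOver-unique (enumeration M e) (enumeration N e′) f = begin
    ∑ M (f ∘ Inverse.to e)
      ≡⟨ ∑-cong M (λ i → cong f (sym (Inverse.strictlyInverseˡ e′ _))) ⟩
    ∑ M (f ∘ Inverse.to e′ ∘ Inverse.to (↔-trans e (↔-sym e′)))
      ≡⟨ ∑-permute (↔-trans e (↔-sym e′)) (f ∘ Inverse.to e′) ⟩
    ∑ N (f ∘ Inverse.to e′)
      ∎
    where open ≡-Reasoning

  sumOver-const : (E : Enumeration A) (c : ℤ) → sumOver E (const c) ≡ + size E *ℤ c
  sumOver-const E = ∑-const (size E)

  sumOver-one : (E : Enumeration A) → sumOver E (const (+ 1)) ≡ + size E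
  sumOver-one E = trans (sumOver-const E (+ 1)) (ℤ.*-identityʳ _)

  via : Enumeration A → A ↔ B → Enumeration B
  via E φ = enumeration (size E) (↔-trans (index E) φ)

  sumOver-via : (E : Enumeration A) (φ : A ↔ B) (f : B → ℤ) → sumOver (via E φ) f ≡ sumOver E (f ∘ Inverse.to φ)
  sumOver-via E φ f = refl

  ⊤-enumeration : Enumeration ⊤
  ⊤-enumeration = enumeration 1 1↔⊤

  ⊥-enumeration : Enumeration ⊥
  ⊥-enumeration = enumeration 0 0↔⊥

  Bool-enumeration : Enumeration Bool
  Bool-enumeration = enumeration 2 2↔Bool

  ⊎-enumeration : Enumeration A → Enumeration B → Enumeration (A ⊎ B)
  ⊎-enumeration E E′ = enumeration (size E + size E′) (↔-trans +↔⊎ (index E ⊎-↔ index E′))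

  sumOver-⊎ : (E : Enumeration A) (E′ : Enumeration B) (f : A ⊎ B → ℤ) →
              sumOver (⊎-enumeration E E′) f ≡ sumOver E (f ∘ inj₁) +ℤ sumOver E′ (f ∘ inj₂)
  sumOver-⊎ E E′ f = trans (∑-+ (size E) (size E′) _) (cong₂ _+ℤ_
    (∑-cong (size E)  (λ i → cong (f ∘ Inverse.to (index E ⊎-↔ index E′)) (splitAt-↑ˡ (size E) i (size E′))))
    (∑-cong (size E′) (λ j → cong (f ∘ Inverse.to (index E ⊎-↔ index E′)) (splitAt-↑ʳ (size E) (size E′) j))))

  Fin-suc-Σ↔ : (B : Fin (suc N) → Set) → (B zero ⊎ Σ (Fin N) (B ∘ suc)) ↔ Σ (Fin (suc N)) B
  Fin-suc-Σ↔ B = mk↔ₛ′ to from (λ { (zero , y) → refl ; (suc i , y) → refl }) (λ { (inj₁ y) → refl ; (inj₂ p) → refl })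
    where
    to : _ ⊎ _ → Σ _ B
    to (inj₁ y)       = zero , y
    to (inj₂ (i , y)) = suc i , y
    from : Σ _ B → _ ⊎ _
    from (zero , y)  = inj₁ y
    from (suc i , y) = inj₂ (i , y)

  ΣFin-enumeration : ∀ N (B : Fin N → Set) → (∀ i → Enumeration (B i)) → Enumeration (Σ (Fin N) B)
  ΣFin-enumeration zero    B E = via ⊥-enumeration (mk↔ₛ′ (λ ()) (λ ()) (λ ()) (λ ()))
  ΣFin-enumeration (suc N) B E = via (⊎-enumeration (E zero) (ΣFin-enumeration N (B ∘ suc) (E ∘ suc))) (Fin-suc-Σ↔ B)

  sumOver-ΣFin : ∀ N (B : Fin N → Set) (E : ∀ i → Enumeration (B i)) (f : Σ (Fin N) B → ℤ) →
                 sumOver (ΣFin-enumeration N B E) f ≡ ∑ N (λ i → sumOver (E i) (λ y → f (i , y)))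
  sumOver-ΣFin zero    B E f = refl
  sumOver-ΣFin (suc N) B E f =
    trans (sumOver-⊎ (E zero) (ΣFin-enumeration N (B ∘ suc) (E ∘ suc)) (f ∘ Inverse.to (Fin-suc-Σ↔ B)))
          (cong (sumOver (E zero) (λ y → f (zero , y)) +ℤ_) (sumOver-ΣFin N (B ∘ suc) (E ∘ suc) (λ (i , y) → f (suc i , y))))

  Σ-enumeration : {B : A → Set} → Enumeration A → (∀ x → Enumeration (B x)) → Enumeration (Σ A B)
  Σ-enumeration {B = B} (enumeration N e) E =
    via (ΣFin-enumeration N (B ∘ Inverse.to e) (E ∘ Inverse.to e)) (Σ-↔ e ↔-refl)

  sumOver-Σ : {B : A → Set} (E : Enumeration A) (E′ : ∀ x → Enumeration (B x)) (f : Σ A B → ℤ) →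
              sumOver (Σ-enumeration E E′) f ≡ sumOver E (λ x → sumOver (E′ x) (λ y → f (x , y)))
  sumOver-Σ {B = B} (enumeration N e) E′ f =
    sumOver-ΣFin N (B ∘ Inverse.to e) (E′ ∘ Inverse.to e) (f ∘ Inverse.to (Σ-↔ {B = B} e ↔-refl))

  ×-enumeration : Enumeration A → Enumeration B → Enumeration (A × B)
  ×-enumeration E E′ = Σ-enumeration E (const E′)

  size-unique : (E E′ : Enumeration A) → size E ≡ size E′
  size-unique E E′ = ℤ.+-injective (begin
    + size E                   ≡⟨ sym (sumOver-one E) ⟩
    sumOver E  (const (+ 1))   ≡⟨ sumOver-unique E E′ _ ⟩
    sumOver E′ (const (+ 1))   ≡⟨ sumOver-one E′ ⟩
    + size E′                  ∎)
    where open ≡-Reasoning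

  size-Σ : ∀ {B : A → Set} {c} (E : Enumeration A) (E′ : ∀ x → Enumeration (B x)) →
           (∀ x → size (E′ x) ≡ c) → size (Σ-enumeration E E′) ≡ size E * c
  size-Σ {c = c} E E′ size≡c = ℤ.+-injective (begin
    + size (Σ-enumeration E E′)                              ≡⟨ sym (sumOver-one (Σ-enumeration E E′)) ⟩
    sumOver (Σ-enumeration E E′) (const (+ 1))               ≡⟨ sumOver-Σ E E′ _ ⟩
    sumOver E (λ x → sumOver (E′ x) (const (+ 1)))           ≡⟨ sumOver-cong E (λ x → trans (sumOver-one (E′ x)) (cong +_ (size≡c x))) ⟩
    sumOver E (const (+ c))                                  ≡⟨ sumOver-const E (+ c) ⟩
    + size E *ℤ + c                                          ≡⟨ ℤ.pos-* (size E) c ⟨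
    + (size E * c)                                           ∎)
    where open ≡-Reasoning

  size-× : (E : Enumeration A) (E′ : Enumeration B) → size (×-enumeration E E′) ≡ size E * size E′
  size-× E E′ = size-Σ E (const E′) (λ _ → refl)


module BinaryShapes where

  open Enumerations
  open import Defs using (catalan)
  open import Data.Nat using (ℕ; zero; suc; _+_; _*_; _∸_; _≤_; _<_; s≤s; _!)
  open import Data.Nat.Properties as ℕ using (_≟_)
  open import Data.Nat.Combinatorics using (_C_; nCk≡n!/k![n-k]!; k![n∸k]!∣n!)
  open import Data.Nat.DivMod using (_/_; m/n*n≡m; m*n/n≡m)
  open import Data.Nat.Tactic.RingSolver using (solve-∀)
  open import Data.Bool using (Bool; true; false)
  open import Data.Empty using (⊥-elim-irr)
  open import Data.Fin using (Fin; toℕ; fromℕ<)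
  open import Data.Fin.Properties using (toℕ≤pred[n]; toℕ-fromℕ<; fromℕ<-toℕ; toℕ<n; fromℕ<-cong)
  open import Data.Product using (Σ; _×_; _,_; proj₁; proj₂)
  open import Data.Sum using (_⊎_; inj₁; inj₂)
  open import Data.Unit using (⊤; tt)
  open import Function using (_∘_; const; _↔_; mk↔ₛ′)
  open import Relation.Binary.PropositionalEquality
    using (_≡_; refl; sym; trans; cong; cong₂; subst; module ≡-Reasoning)
  open import Relation.Nullary.Decidable using (recompute)

  data Shape : Set where
    leaf : Shape
    node : Shape → Shape → Shape

  internal : Shape → ℕ
  internal leaf       = 0
  internal (node a b) = suc (internal a + internal b)

  record Shapes (k : ℕ) : Set where
    constructor shape
    field
      tree         : Shape
      .internal≡k  : internal tree ≡ k
  open Shapes public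

  internal-tree : ∀ {k} (s : Shapes k) → internal (tree s) ≡ k
  internal-tree {k} (shape t p) = recompute (internal t ≟ k) p

  private
    leaf-shape : Shapes 0
    leaf-shape = shape leaf refl

    leaf-unique : (s : Shapes 0) → leaf-shape ≡ s
    leaf-unique (shape leaf       p) = refl
    leaf-unique (shape (node _ _) p) = ⊥-elim-irr (ℕ.0≢1+n (sym p))

  RootSplit : ℕ → Set
  RootSplit k = Σ (Fin (suc k)) (λ i → Shapes (toℕ i) × Shapes (k ∸ toℕ i))

  rootSplit↔ : ∀ k → RootSplit k ↔ Shapes (suc k)
  rootSplit↔ k = mk↔ₛ′ join split join-split split-join
    where
    join : RootSplit k → Shapes (suc k)
    join (i , shape a pa , shape b pb) =
      shape (node a b) (cong suc (trans (cong₂ _+_ pa pb) (ℕ.m+[n∸m]≡n (toℕ≤pred[n] i))))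

    splitAt : ∀ a b → internal a + internal b ≡ k → RootSplit k
    splitAt a b a+b≡k = fromℕ< a<1+k , shape a (sym (toℕ-fromℕ< a<1+k)) ,
        shape b (trans (sym (ℕ.m+n∸m≡n (internal a) (internal b))) (cong₂ _∸_ a+b≡k (sym (toℕ-fromℕ< a<1+k))))
      where
      a<1+k : internal a < suc k
      a<1+k = s≤s (subst (internal a ≤_) a+b≡k (ℕ.m≤m+n (internal a) (internal b)))

    split : Shapes (suc k) → RootSplit k
    split (shape leaf       p) = ⊥-elim-irr (ℕ.0≢1+n p)
    split (shape (node a b) p) = splitAt a b (recompute (internal a + internal b ≟ k) (ℕ.suc-injective p))

    join-split : ∀ s → join (split s) ≡ s
    join-split (shape leaf       p) = ⊥-elim-irr (ℕ.0≢1+n p)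
    join-split (shape (node a b) p) = refl

    same-split : ∀ {i j} {a b} .{pa pb pa′ pb′} → i ≡ j →
                 _≡_ {A = RootSplit k} (i , shape a pa , shape b pb) (j , shape a pa′ , shape b pb′)
    same-split refl = refl

    split-join : ∀ x → split (join x) ≡ x
    split-join (i , shape a pa , shape b pb) =
      same-split (trans (fromℕ<-cong _ _ (recompute (internal a ≟ toℕ i) pa) _ _) (fromℕ<-toℕ i (toℕ<n i)))

  -- K is fuel bounding k, which makes the recursion through the root split structural.
  shapes-enumeration′ : ∀ K k → k ≤ K → Enumeration (Shapes k)
  shapes-enumeration′ K       zero    _         = via ⊤-enumeration (mk↔ₛ′ (const leaf-shape) (const tt) leaf-unique (λ _ → refl))
  shapes-enumeration′ (suc K) (suc k) (s≤s k≤K) = via (ΣFin-enumeration (suc k) _ λ i →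
      ×-enumeration (shapes-enumeration′ K (toℕ i)     (ℕ.≤-trans (toℕ≤pred[n] i) k≤K))
                    (shapes-enumeration′ K (k ∸ toℕ i) (ℕ.≤-trans (ℕ.m∸n≤m k (toℕ i)) k≤K)))
    (rootSplit↔ k)

  shapes-enumeration : ∀ k → Enumeration (Shapes k)
  shapes-enumeration k = shapes-enumeration′ k k ℕ.≤-refl

  #shapes : ℕ → ℕ
  #shapes k = size (shapes-enumeration k)

  nodes : Shape → ℕ
  nodes leaf       = 1
  nodes (node a b) = suc (nodes a + nodes b)

  nodes≡ : ∀ s → nodes s ≡ suc (2 * internal s)
  nodes≡ leaf       = refl
  nodes≡ (node a b) = trans (cong₂ (λ x y → suc (x + y)) (nodes≡ a) (nodes≡ b)) (odd+odd (internal a) (internal b))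
    where
    odd+odd : ∀ x y → suc (suc (2 * x) + suc (2 * y)) ≡ suc (2 * suc (x + y))
    odd+odd = solve-∀

  data Node : Shape → Set where
    root  : ∀ {s} → Node s
    left  : ∀ {a b} → Node a → Node (node a b)
    right : ∀ {a b} → Node b → Node (node a b)

  data Leaf : Shape → Set where
    here  : Leaf leaf
    left  : ∀ {a b} → Leaf a → Leaf (node a b)
    right : ∀ {a b} → Leaf b → Leaf (node a b)

  node-enumeration : ∀ s → Enumeration (Node s)
  node-enumeration leaf       = via ⊤-enumeration (mk↔ₛ′ (const root) (const tt) (λ { root → refl }) (λ _ → refl))
  node-enumeration (node a b) = via (⊎-enumeration ⊤-enumeration (⊎-enumeration (node-enumeration a) (node-enumeration b)))
    (mk↔ₛ′ to from (λ { root → refl ; (left p) → refl ; (right p) → refl })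
                   (λ { (inj₁ tt) → refl ; (inj₂ (inj₁ p)) → refl ; (inj₂ (inj₂ p)) → refl }))
    where
    to : ⊤ ⊎ (Node a ⊎ Node b) → Node (node a b)
    to (inj₁ _)         = root
    to (inj₂ (inj₁ p))  = left p
    to (inj₂ (inj₂ p))  = right p
    from : Node (node a b) → ⊤ ⊎ (Node a ⊎ Node b)
    from root      = inj₁ tt
    from (left p)  = inj₂ (inj₁ p)
    from (right p) = inj₂ (inj₂ p)

  leaf-enumeration : ∀ s → Enumeration (Leaf s)
  leaf-enumeration leaf       = via ⊤-enumeration (mk↔ₛ′ (const here) (const tt) (λ { here → refl }) (λ _ → refl))
  leaf-enumeration (node a b) = via (⊎-enumeration (leaf-enumeration a) (leaf-enumeration b))
    (mk↔ₛ′ to from (λ { (left p) → refl ; (right p) → refl }) (λ { (inj₁ p) → refl ; (inj₂ p) → refl }))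
    where
    to : Leaf a ⊎ Leaf b → Leaf (node a b)
    to (inj₁ p) = left p
    to (inj₂ p) = right p
    from : Leaf (node a b) → Leaf a ⊎ Leaf b
    from (left p)  = inj₁ p
    from (right p) = inj₂ p

  size-node-enumeration : ∀ s → size (node-enumeration s) ≡ nodes s
  size-node-enumeration leaf       = refl
  size-node-enumeration (node a b) = cong₂ (λ x y → suc (x + y)) (size-node-enumeration a) (size-node-enumeration b)

  size-leaf-enumeration : ∀ s → size (leaf-enumeration s) ≡ suc (internal s)
  size-leaf-enumeration leaf       = refl
  size-leaf-enumeration (node a b) =
    trans (cong₂ _+_ (size-leaf-enumeration a) (size-leaf-enumeration b)) (cong suc (ℕ.+-suc (internal a) (internal b)))

  record LeafMarked : Set where
    constructor leafMarked
    field
      lsub rsub : Shape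
      marked    : Leaf (node lsub rsub)

  NodeMarked : Set
  NodeMarked = Σ Shape (λ s → Node s × Bool)

  -- Rémy's grafting: the subtree at the marked node becomes a child of a new internal node whose
  -- other child is the new marked leaf, placed on the right when the flag is true.
  graft : (s : Shape) → Node s → Bool → LeafMarked
  graft s root false = leafMarked leaf s (left here)
  graft s root true  = leafMarked s leaf (right here)
  graft (node a b) (left p) d with graft a p d
  ... | leafMarked x y q = leafMarked (node x y) b (left q)
  graft (node a b) (right p) d with graft b p d
  ... | leafMarked x y q = leafMarked a (node x y) (right q)

  prune : (a b : Shape) → Leaf (node a b) → NodeMarked
  pruneLeft  : (a b : Shape) → Leaf a → NodeMarked
  pruneRight : (a b : Shape) → Leaf b → NodeMarked

  prune a b (left q)  = pruneLeft a b q
  prune a b (right q) = pruneRight a b q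

  pruneLeft leaf         b here = b , root , false
  pruneLeft (node a₁ a₂) b q with prune a₁ a₂ q
  ... | t , p , d = node t b , left p , d

  pruneRight a leaf         here = a , root , true
  pruneRight a (node b₁ b₂) q with prune b₁ b₂ q
  ... | t , p , d = node a t , right p , d

  graftedTree : LeafMarked → Shape
  graftedTree (leafMarked a b _) = node a b

  prune′ : LeafMarked → NodeMarked
  prune′ (leafMarked a b q) = prune a b q

  prune-graft : ∀ s p d → prune′ (graft s p d) ≡ (s , p , d)
  prune-graft s          root      false = refl
  prune-graft leaf       root      true  = refl
  prune-graft (node a b) root      true  = refl
  prune-graft (node a b) (left p)  d with graft a p d | prune-graft a p d
  ... | leafMarked x y q | eq rewrite eq = refl
  prune-graft (node a b) (right p) d with graft b p d | prune-graft b p d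
  ... | leafMarked x y q | eq rewrite eq = refl

  graft-prune : ∀ a b q → (λ (s , p , d) → graft s p d) (prune a b q) ≡ leafMarked a b q
  graft-prune leaf         b            (left here)  = refl
  graft-prune (node a₁ a₂) b            (left q)     with prune a₁ a₂ q | graft-prune a₁ a₂ q
  ... | t , p , d | eq rewrite eq = refl
  graft-prune leaf         leaf         (right here) = refl
  graft-prune (node _ _)   leaf         (right here) = refl
  graft-prune a            (node b₁ b₂) (right q)    with prune b₁ b₂ q | graft-prune b₁ b₂ q
  ... | t , p , d | eq rewrite eq = refl

  internal-graft : ∀ s p d → internal (graftedTree (graft s p d)) ≡ suc (internal s)
  internal-graft s          root      false = refl
  internal-graft s          root      true  = cong suc (ℕ.+-identityʳ (internal s))
  internal-graft (node a b) (left p)  d with graft a p d | internal-graft a p d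
  ... | leafMarked x y q | eq = cong (λ z → suc (z + internal b)) eq
  internal-graft (node a b) (right p) d with graft b p d | internal-graft b p d
  ... | leafMarked x y q | eq = cong suc (trans (cong (internal a +_) eq) (ℕ.+-suc (internal a) (internal b)))

  internal-prune : ∀ a b q → internal (node a b) ≡ suc (internal (proj₁ (prune a b q)))
  internal-prune a b q with prune a b q | graft-prune a b q
  ... | s , p , d | eq = trans (cong (internal ∘ graftedTree) (sym eq)) (internal-graft s p d)

  LeafMarkedShapes NodeMarkedShapes : ℕ → Set
  LeafMarkedShapes k = Σ (Shapes k) (Leaf ∘ tree)
  NodeMarkedShapes k = Σ (Shapes k) (λ s → Node (tree s) × Bool)

  remy : ∀ k → LeafMarkedShapes (suc k) ↔ NodeMarkedShapes k
  remy k = mk↔ₛ′ to from to-from from-to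
    where
    to : LeafMarkedShapes (suc k) → NodeMarkedShapes k
    to (shape leaf       p , _) = ⊥-elim-irr (ℕ.0≢1+n p)
    to (shape (node a b) p , q) =
      shape (proj₁ (prune a b q)) (ℕ.suc-injective (trans (sym (internal-prune a b q)) p)) , proj₂ (prune a b q)

    from : NodeMarkedShapes k → LeafMarkedShapes (suc k)
    from (shape s p , n , d) =
      shape (graftedTree (graft s n d)) (trans (internal-graft s n d) (cong suc p)) , LeafMarked.marked (graft s n d)

    same-nodeMarked : ∀ {x y : NodeMarked} → x ≡ y → .(px : internal (proj₁ x) ≡ k) .(py : internal (proj₁ y) ≡ k) →
                      _≡_ {A = NodeMarkedShapes k} (shape (proj₁ x) px , proj₂ x) (shape (proj₁ y) py , proj₂ y)
    same-nodeMarked refl _ _ = refl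

    same-leafMarked : ∀ {x y : LeafMarked} → x ≡ y →
                      .(px : internal (graftedTree x) ≡ suc k) .(py : internal (graftedTree y) ≡ suc k) →
                      _≡_ {A = LeafMarkedShapes (suc k)}
                          (shape (graftedTree x) px , LeafMarked.marked x) (shape (graftedTree y) py , LeafMarked.marked y)
    same-leafMarked refl _ _ = refl

    to-from : ∀ x → to (from x) ≡ x
    to-from (shape s p , n , d) = same-nodeMarked (prune-graft s n d) _ p

    from-to : ∀ x → from (to x) ≡ x
    from-to (shape leaf       p , _) = ⊥-elim-irr (ℕ.0≢1+n p)
    from-to (shape (node a b) p , q) = same-leafMarked (graft-prune a b q) _ p

  #shapes-suc : ∀ k → #shapes (suc k) * suc (suc k) ≡ #shapes k * (suc (2 * k) * 2)
  #shapes-suc k = begin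
    #shapes (suc k) * suc (suc k)
      ≡⟨ size-Σ (shapes-enumeration (suc k)) (leaf-enumeration ∘ tree)
                (λ s → trans (size-leaf-enumeration (tree s)) (cong suc (internal-tree s))) ⟨
    size leafMarked-enumeration
      ≡⟨ size-unique (via leafMarked-enumeration (remy k)) nodeMarked-enumeration ⟩
    size nodeMarked-enumeration
      ≡⟨ size-Σ (shapes-enumeration k) (λ s → ×-enumeration (node-enumeration (tree s)) Bool-enumeration) (λ s →
           trans (size-× (node-enumeration (tree s)) Bool-enumeration)
                 (cong (_* 2) (trans (size-node-enumeration (tree s)) (trans (nodes≡ (tree s)) (cong (suc ∘ (2 *_)) (internal-tree s)))))) ⟩
    #shapes k * (suc (2 * k) * 2) ∎
    where
    open ≡-Reasoning
    leafMarked-enumeration : Enumeration (LeafMarkedShapes (suc k))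
    leafMarked-enumeration = Σ-enumeration (shapes-enumeration (suc k)) (leaf-enumeration ∘ tree)
    nodeMarked-enumeration : Enumeration (NodeMarkedShapes k)
    nodeMarked-enumeration = Σ-enumeration (shapes-enumeration k) (λ s → ×-enumeration (node-enumeration (tree s)) Bool-enumeration)

  C*factorials≡! : ∀ {n k} → k ≤ n → (n C k) * (k ! * (n ∸ k) !) ≡ n !
  C*factorials≡! {n} {k} k≤n =
    trans (cong (_* (k ! * (n ∸ k) !)) (nCk≡n!/k![n-k]! k≤n)) (m/n*n≡m (k![n∸k]!∣n! k≤n))
    where instance _ = ℕ._!*_!≢0 k (n ∸ k)

  central-C*factorials : ∀ k → ((2 * k) C k) * (k ! * k !) ≡ (2 * k) !
  central-C*factorials k =
    trans (cong (λ j → ((2 * k) C k) * (k ! * j !)) (sym 2k∸k≡k)) (C*factorials≡! (ℕ.m≤m+n k (k + 0)))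
    where
    2k∸k≡k : 2 * k ∸ k ≡ k
    2k∸k≡k = trans (ℕ.m+n∸m≡n k (k + 0)) (ℕ.+-identityʳ k)

  central-C-suc : ∀ k → ((2 * suc k) C suc k) * suc k ≡ ((2 * k) C k) * (suc (2 * k) * 2)
  central-C-suc k = ℕ.*-cancelʳ-≡ _ _ (suc k * k!²) (begin
    ((2 * suc k) C suc k) * suc k * (suc k * k!²)              ≡⟨ regroup ((2 * suc k) C suc k) (suc k) (k !) ⟩
    ((2 * suc k) C suc k) * (suc k ! * suc k !)                ≡⟨ central-C*factorials (suc k) ⟩
    (2 * suc k) !                                              ≡⟨ cong _! (2[1+k]≡2+2k k) ⟩
    suc (suc (2 * k)) * (suc (2 * k) * (2 * k) !)              ≡⟨ cong (λ j → suc (suc (2 * k)) * (suc (2 * k) * j)) (central-C*factorials k) ⟨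
    suc (suc (2 * k)) * (suc (2 * k) * (((2 * k) C k) * k!²))  ≡⟨ regroup′ k ((2 * k) C k) k!² ⟩
    ((2 * k) C k) * (suc (2 * k) * 2) * (suc k * k!²)          ∎)
    where
    open ≡-Reasoning
    k!² = k ! * k !
    instance _ = ℕ.m*n≢0 (suc k) k!² {{_}} {{ℕ._!*_!≢0 k k}}
    regroup : ∀ c s f → c * s * (s * (f * f)) ≡ c * ((s * f) * (s * f))
    regroup = solve-∀
    2[1+k]≡2+2k : ∀ k → 2 * suc k ≡ suc (suc (2 * k))
    2[1+k]≡2+2k = solve-∀
    regroup′ : ∀ k c f → suc (suc (2 * k)) * (suc (2 * k) * (c * f)) ≡ c * (suc (2 * k) * 2) * (suc k * f)
    regroup′ = solve-∀

  #shapes*suc≡central-C : ∀ k → #shapes k * suc k ≡ (2 * k) C k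
  #shapes*suc≡central-C zero    = refl
  #shapes*suc≡central-C (suc k) = ℕ.*-cancelʳ-≡ _ _ (suc k) (begin
    #shapes (suc k) * suc (suc k) * suc k   ≡⟨ cong (_* suc k) (#shapes-suc k) ⟩
    #shapes k * (suc (2 * k) * 2) * suc k   ≡⟨ swap (#shapes k) (suc (2 * k) * 2) (suc k) ⟩
    #shapes k * suc k * (suc (2 * k) * 2)   ≡⟨ cong (_* (suc (2 * k) * 2)) (#shapes*suc≡central-C k) ⟩
    ((2 * k) C k) * (suc (2 * k) * 2)       ≡⟨ central-C-suc k ⟨
    ((2 * suc k) C suc k) * suc k           ∎)
    where
    open ≡-Reasoning
    swap : ∀ a b c → a * b * c ≡ a * c * b
    swap = solve-∀

  #shapes≡catalan : ∀ k → #shapes k ≡ catalan k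
  #shapes≡catalan k = begin
    #shapes k                   ≡⟨ m*n/n≡m (#shapes k) (suc k) ⟨
    #shapes k * suc k / suc k   ≡⟨ cong (_/ suc k) (#shapes*suc≡central-C k) ⟩
    ((2 * k) C k) / suc k       ∎
    where open ≡-Reasoning


module UnimodalWords where

  open import Defs using (range; Unimodal)
  open import Data.Nat as ℕ using (ℕ; zero; suc; _+_; _≤_; _<_; _>_; s≤s; z≤n; _≡ᵇ_; _<ᵇ_)
  import Data.Nat.Properties as ℕ
  open import Data.Bool as Bool using (Bool; true; false; _∧_; _∨_; not; if_then_else_; f≤t; b≤b)
  import Data.Bool.Properties as Bool
  open import Data.List as List using (List; []; _∷_; _++_; [_]; map; length)
  import Data.List.Properties as List
  open import Data.List.Relation.Unary.Linked as Linked using (Linked; []; [-]; _∷_)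
  import Data.List.Relation.Unary.Linked.Properties as Linked
  open import Data.Vec using ([]; _∷_; zipWith)
  open import Data.Vec.Relation.Binary.Pointwise.Inductive using (Pointwise; []; _∷_)
  open import Data.Fin.Subset using (Subset; ∣_∣; _─_) renaming (⊤ to full; ⊥ to ∅)
  open import Data.Empty using (⊥-elim)
  open import Data.Product using (Σ; _×_; _,_)
  open import Data.Sum using (_⊎_; inj₁; inj₂)
  open import Function using (_∘_; id; Equivalence)
  open import Relation.Binary using (Trichotomous; tri<; tri≈; tri>)
  open import Relation.Binary.PropositionalEquality
    using (_≡_; _≢_; refl; sym; trans; cong; cong₂; subst; module ≡-Reasoning)
  open import Relation.Nullary using (¬_)

  bit : Bool → ℕ
  bit true  = 1
  bit false = 0

  nonzero : ℕ → Bool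
  nonzero zero    = false
  nonzero (suc _) = true

  bit≤1 : ∀ b → bit b ≤ 1
  bit≤1 true  = s≤s z≤n
  bit≤1 false = z≤n

  bit-nonzero : ∀ c → c ≤ 1 → bit (nonzero c) ≡ c
  bit-nonzero zero          _        = refl
  bit-nonzero (suc zero)    _        = refl
  bit-nonzero (suc (suc c)) (s≤s ())

  nonzero-bit : ∀ b → nonzero (bit b) ≡ b
  nonzero-bit true  = refl
  nonzero-bit false = refl

  bit-∧-nonzero : ∀ b c → c ≤ bit b → bit (b ∧ nonzero c) ≡ c
  bit-∧-nonzero true  c    c≤1 = bit-nonzero c c≤1
  bit-∧-nonzero false zero _   = refl

  ≡ᵇ-refl : ∀ x → (x ≡ᵇ x) ≡ true
  ≡ᵇ-refl x = Equivalence.to Bool.T-≡ (ℕ.≡⇒≡ᵇ x x refl)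

  ≡ᵇ⇒≡ : ∀ x y → (x ≡ᵇ y) ≡ true → x ≡ y
  ≡ᵇ⇒≡ x y eq = ℕ.≡ᵇ⇒≡ x y (Equivalence.from Bool.T-≡ eq)

  ≢⇒≡ᵇ-false : ∀ x y → x ≢ y → (x ≡ᵇ y) ≡ false
  ≢⇒≡ᵇ-false x y x≢y with x ≡ᵇ y in eq
  ... | true  = ⊥-elim (x≢y (≡ᵇ⇒≡ x y eq))
  ... | false = refl

  occ : ℕ → List ℕ → ℕ
  occ x []       = 0
  occ x (y ∷ ys) = bit (x ≡ᵇ y) + occ x ys

  occ-++ : ∀ x xs ys → occ x (xs ++ ys) ≡ occ x xs + occ x ys
  occ-++ x []       ys = refl
  occ-++ x (y ∷ xs) ys = trans (cong (bit (x ≡ᵇ y) +_) (occ-++ x xs ys)) (sym (ℕ.+-assoc (bit (x ≡ᵇ y)) _ _))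

  occ-zero-map-suc : ∀ xs → occ 0 (map suc xs) ≡ 0
  occ-zero-map-suc []       = refl
  occ-zero-map-suc (x ∷ xs) = occ-zero-map-suc xs

  occ-suc-map-suc : ∀ x xs → occ (suc x) (map suc xs) ≡ occ x xs
  occ-suc-map-suc x []       = refl
  occ-suc-map-suc x (y ∷ xs) = cong (bit (x ≡ᵇ y) +_) (occ-suc-map-suc x xs)

  occ-suc-map-pred : ∀ x xs → occ (suc x) (map ℕ.pred xs) ≡ occ (suc (suc x)) xs
  occ-suc-map-pred x []           = refl
  occ-suc-map-pred x (zero  ∷ xs) = occ-suc-map-pred x xs
  occ-suc-map-pred x (suc y ∷ xs) = cong (bit (suc x ≡ᵇ y) +_) (occ-suc-map-pred x xs)

  infix 4 _∈ₒ_
  _∈ₒ_ : ℕ → List ℕ → Set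
  x ∈ₒ xs = 0 < occ x xs

  ∈ₒ-head : ∀ x xs → x ∈ₒ x ∷ xs
  ∈ₒ-head x xs rewrite ≡ᵇ-refl x = s≤s z≤n

  ∈ₒ-++ʳ : ∀ x xs ys → x ∈ₒ ys → x ∈ₒ xs ++ ys
  ∈ₒ-++ʳ x xs ys x∈ys rewrite occ-++ x xs ys = ℕ.≤-trans x∈ys (ℕ.m≤n+m _ _)

  ∈ₒ-∷ : ∀ x y xs → x ∈ₒ y ∷ xs → x ≡ y ⊎ x ∈ₒ xs
  ∈ₒ-∷ x y xs x∈ with x ≡ᵇ y in eq
  ... | true  = inj₁ (≡ᵇ⇒≡ x y eq)
  ... | false = inj₂ x∈

  ∈ₒ-map-suc : ∀ x xs → x ∈ₒ map suc xs → Σ ℕ (λ y → x ≡ suc y × y ∈ₒ xs)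
  ∈ₒ-map-suc zero    xs x∈ rewrite occ-zero-map-suc xs = ⊥-elim (ℕ.<-irrefl refl x∈)
  ∈ₒ-map-suc (suc x) xs x∈ rewrite occ-suc-map-suc x xs = x , refl , x∈

  module StrictlySorted {R : ℕ → ℕ → Set}
    (R-trans : ∀ {x y z} → R x y → R y z → R x z) (R-irrefl : ∀ {x} → ¬ R x x) (R-cmp : Trichotomous _≡_ R) where

    linked-head : ∀ {y xs x} → Linked R (y ∷ xs) → x ∈ₒ xs → R y x
    linked-head {xs = z ∷ xs} {x} (Ryz ∷ l) x∈ with ∈ₒ-∷ x z xs x∈
    ... | inj₁ refl = Ryz
    ... | inj₂ x∈xs = R-trans Ryz (linked-head l x∈xs)

    linked-∷ : ∀ {y xs} → (∀ x → x ∈ₒ xs → R y x) → Linked R xs → Linked R (y ∷ xs)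
    linked-∷ {xs = []}     _       _ = [-]
    linked-∷ {xs = z ∷ xs} y-below l = y-below z (∈ₒ-head z xs) ∷ l

    linked-∷ʳ : ∀ {xs y} → Linked R xs → (∀ x → x ∈ₒ xs → R x y) → Linked R (xs ++ [ y ])
    linked-∷ʳ {[]}          _         _       = [-]
    linked-∷ʳ {x ∷ []}      _         y-above = y-above x (∈ₒ-head x []) ∷ [-]
    linked-∷ʳ {x ∷ x′ ∷ xs} (Rxx′ ∷ l) y-above = Rxx′ ∷ linked-∷ʳ l (λ z z∈ → y-above z (∈ₒ-++ʳ z [ x ] (x′ ∷ xs) z∈))

    linked-++⁻ˡ : ∀ {xs ys} → Linked R (xs ++ ys) → Linked R xs
    linked-++⁻ˡ {[]}          _          = []
    linked-++⁻ˡ {x ∷ []}      _          = [-]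
    linked-++⁻ˡ {x ∷ x′ ∷ xs} (Rxx′ ∷ l) = Rxx′ ∷ linked-++⁻ˡ l

    linked-last : ∀ {xs y x} → Linked R (xs ++ [ y ]) → x ∈ₒ xs → R x y
    linked-last {z ∷ xs} {y} {x} l x∈ with ∈ₒ-∷ x z xs x∈
    ... | inj₁ refl = linked-head l (∈ₒ-++ʳ y xs [ y ] (∈ₒ-head y []))
    ... | inj₂ x∈xs = linked-last (Linked.tail l) x∈xs

    ∉-below-head : ∀ {x y ys} → Linked R (y ∷ ys) → R x y → ¬ x ∈ₒ y ∷ ys
    ∉-below-head {x} {y} {ys} l Rxy x∈ with ∈ₒ-∷ x y ys x∈
    ... | inj₁ refl = R-irrefl Rxy
    ... | inj₂ x∈ys = R-irrefl (R-trans Rxy (linked-head l x∈ys))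

    -- The smaller of the two heads cannot occur in the other list.
    linked-occ-unique : ∀ {xs ys} → Linked R xs → Linked R ys → (∀ x → occ x xs ≡ occ x ys) → xs ≡ ys
    linked-occ-unique {[]}     {[]}     _  _  _   = refl
    linked-occ-unique {[]}     {y ∷ ys} _  _  occ≡ with () ← subst (0 <_) (sym (occ≡ y)) (∈ₒ-head y ys)
    linked-occ-unique {x ∷ xs} {[]}     _  _  occ≡ with () ← subst (0 <_) (occ≡ x) (∈ₒ-head x xs)
    linked-occ-unique {x ∷ xs} {y ∷ ys} lx ly occ≡ with R-cmp x y
    ... | tri≈ _ refl _ = cong (x ∷_) (linked-occ-unique (Linked.tail lx) (Linked.tail ly)
                                        (λ z → ℕ.+-cancelˡ-≡ (bit (z ≡ᵇ x)) _ _ (occ≡ z)))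
    ... | tri< Rxy _ _ = ⊥-elim (∉-below-head ly Rxy (subst (0 <_) (occ≡ x) (∈ₒ-head x xs)))
    ... | tri> _ _ Ryx = ⊥-elim (∉-below-head lx Ryx (subst (0 <_) (sym (occ≡ y)) (∈ₒ-head y ys)))

  >-cmp : Trichotomous _≡_ _>_
  >-cmp x y with ℕ.<-cmp y x
  ... | tri< y<x y≢x y≮x = tri< y<x (y≢x ∘ sym) y≮x
  ... | tri≈ y≮x y≡x x≮y = tri≈ y≮x (sym y≡x) x≮y
  ... | tri> y≮x y≢x x<y = tri> y≮x (y≢x ∘ sym) x<y

  module Ascending  = StrictlySorted ℕ.<-trans (ℕ.<-irrefl refl) ℕ.<-cmp
  module Descending = StrictlySorted (λ y<x z<y → ℕ.<-trans z<y y<x) (ℕ.<-irrefl refl) >-cmp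

  -- Letter x ≥ 1 stands for the element x - 1 of Fin m, as in the definition of OddComp.
  hasIndex : ∀ {m} → Subset m → ℕ → Bool
  hasIndex []      _       = false
  hasIndex (b ∷ S) zero    = b
  hasIndex (b ∷ S) (suc i) = hasIndex S i

  hasLetter : ∀ {m} → Subset m → ℕ → Bool
  hasLetter S zero    = false
  hasLetter S (suc i) = hasIndex S i

  inRange : ℕ → ℕ → Bool
  inRange m = hasLetter (full {m})

  hasIndex-ext : ∀ {m} (S S′ : Subset m) → (∀ i → hasIndex S i ≡ hasIndex S′ i) → S ≡ S′
  hasIndex-ext []      []       _ = refl
  hasIndex-ext (b ∷ S) (b′ ∷ S′) same = cong₂ _∷_ (same 0) (hasIndex-ext S S′ (same ∘ suc))

  hasLetter-ext : ∀ {m} (S S′ : Subset m) → (∀ x → hasLetter S x ≡ hasLetter S′ x) → S ≡ S′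
  hasLetter-ext S S′ same = hasIndex-ext S S′ (same ∘ suc)

  hasIndex-zipWith : ∀ {m} (f : Bool → Bool → Bool) → f false false ≡ false → (S S′ : Subset m) → ∀ i →
                     hasIndex (zipWith f S S′) i ≡ f (hasIndex S i) (hasIndex S′ i)
  hasIndex-zipWith f f00 []      []       i       = sym f00
  hasIndex-zipWith f f00 (b ∷ S) (b′ ∷ S′) zero    = refl
  hasIndex-zipWith f f00 (b ∷ S) (b′ ∷ S′) (suc i) = hasIndex-zipWith f f00 S S′ i

  hasLetter-zipWith : ∀ {m} (f : Bool → Bool → Bool) → f false false ≡ false → (S S′ : Subset m) → ∀ x →
                      hasLetter (zipWith f S S′) x ≡ f (hasLetter S x) (hasLetter S′ x)
  hasLetter-zipWith f f00 S S′ zero    = sym f00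
  hasLetter-zipWith f f00 S S′ (suc i) = hasIndex-zipWith f f00 S S′ i

  hasIndex-∅ : ∀ m i → hasIndex (∅ {m}) i ≡ false
  hasIndex-∅ zero    i       = refl
  hasIndex-∅ (suc m) zero    = refl
  hasIndex-∅ (suc m) (suc i) = hasIndex-∅ m i

  hasLetter-∅ : ∀ m x → hasLetter (∅ {m}) x ≡ false
  hasLetter-∅ m zero    = refl
  hasLetter-∅ m (suc i) = hasIndex-∅ m i

  hasIndex⇒full : ∀ {m} (S : Subset m) i → hasIndex S i ≡ true → hasIndex (full {m}) i ≡ true
  hasIndex⇒full (b ∷ S) zero    _  = refl
  hasIndex⇒full (b ∷ S) (suc i) ∈S = hasIndex⇒full S i ∈S

  hasLetter⇒inRange : ∀ {m} (S : Subset m) x → hasLetter S x ≡ true → inRange m x ≡ true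
  hasLetter⇒inRange S (suc i) ∈S = hasIndex⇒full S i ∈S

  inRange-∧-hasLetter : ∀ {m} (S : Subset m) x → inRange m x ∧ hasLetter S x ≡ hasLetter S x
  inRange-∧-hasLetter {m} S x with hasLetter S x in ∈S
  ... | true  rewrite hasLetter⇒inRange S x ∈S = refl
  ... | false = Bool.∧-zeroʳ _

  ∣∷∣ : ∀ {m} b (S : Subset m) → ∣ b ∷ S ∣ ≡ bit b + ∣ S ∣
  ∣∷∣ true  S = refl
  ∣∷∣ false S = refl

  ascending : ∀ {m} → Subset m → List ℕ
  ascending []          = []
  ascending (true  ∷ S) = 1 ∷ map suc (ascending S)
  ascending (false ∷ S) = map suc (ascending S)

  descending : ∀ {m} → Subset m → List ℕ
  descending []          = []
  descending (true  ∷ S) = map suc (descending S) ++ [ 1 ]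
  descending (false ∷ S) = map suc (descending S)

  occ-ascending : ∀ {m} (S : Subset m) x → occ x (ascending S) ≡ bit (hasLetter S x)
  occ-ascending []          zero          = refl
  occ-ascending []          (suc x)       = refl
  occ-ascending (b     ∷ S) zero          with b
  ... | true  = occ-zero-map-suc (ascending S)
  ... | false = occ-zero-map-suc (ascending S)
  occ-ascending (true  ∷ S) (suc zero)    = cong suc (trans (occ-suc-map-suc 0 (ascending S)) (occ-ascending S 0))
  occ-ascending (false ∷ S) (suc zero)    = trans (occ-suc-map-suc 0 (ascending S)) (occ-ascending S 0)
  occ-ascending (b     ∷ S) (suc (suc x)) with b
  ... | true  = trans (occ-suc-map-suc (suc x) (ascending S)) (occ-ascending S (suc x))
  ... | false = trans (occ-suc-map-suc (suc x) (ascending S)) (occ-ascending S (suc x))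

  occ-descending : ∀ {m} (S : Subset m) x → occ x (descending S) ≡ bit (hasLetter S x)
  occ-descending []          zero          = refl
  occ-descending []          (suc x)       = refl
  occ-descending (true  ∷ S) x             = trans (occ-++ x (map suc (descending S)) [ 1 ]) (occ-init-last x)
    where
    occ-init-last : ∀ x → occ x (map suc (descending S)) + occ x [ 1 ] ≡ bit (hasLetter (true ∷ S) x)
    occ-init-last zero          = cong (_+ 0) (occ-zero-map-suc (descending S))
    occ-init-last (suc zero)    = cong (_+ 1) (trans (occ-suc-map-suc 0 (descending S)) (occ-descending S 0))
    occ-init-last (suc (suc x)) =
      trans (ℕ.+-identityʳ _) (trans (occ-suc-map-suc (suc x) (descending S)) (occ-descending S (suc x)))
  occ-descending (false ∷ S) zero          = occ-zero-map-suc (descending S)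
  occ-descending (false ∷ S) (suc zero)    = trans (occ-suc-map-suc 0 (descending S)) (occ-descending S 0)
  occ-descending (false ∷ S) (suc (suc x)) = trans (occ-suc-map-suc (suc x) (descending S)) (occ-descending S (suc x))

  length-ascending : ∀ {m} (S : Subset m) → length (ascending S) ≡ ∣ S ∣
  length-ascending []          = refl
  length-ascending (true  ∷ S) = cong suc (trans (List.length-map suc (ascending S)) (length-ascending S))
  length-ascending (false ∷ S) = trans (List.length-map suc (ascending S)) (length-ascending S)

  length-descending : ∀ {m} (S : Subset m) → length (descending S) ≡ ∣ S ∣
  length-descending []          = refl
  length-descending (true  ∷ S) = begin
    length (map suc (descending S) ++ [ 1 ])   ≡⟨ List.length-++ (map suc (descending S)) ⟩
    length (map suc (descending S)) + 1        ≡⟨ ℕ.+-comm _ 1 ⟩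
    suc (length (map suc (descending S)))      ≡⟨ cong suc (trans (List.length-map suc (descending S)) (length-descending S)) ⟩
    suc ∣ S ∣                                  ∎
    where open ≡-Reasoning
  length-descending (false ∷ S) = trans (List.length-map suc (descending S)) (length-descending S)

  positive-letter : ∀ {m} (S : Subset m) {x} → bit (hasLetter S x) > 0 → x > 0
  positive-letter S {suc x} _ = s≤s z≤n

  map-suc-above-1 : ∀ {m} (S : Subset m) (list : Subset m → List ℕ) → (∀ x → occ x (list S) ≡ bit (hasLetter S x)) →
                    ∀ x → x ∈ₒ map suc (list S) → 1 < x
  map-suc-above-1 S list occ-list x x∈ with ∈ₒ-map-suc x (list S) x∈
  ... | y , refl , y∈ = s≤s (positive-letter S (subst (0 <_) (occ-list y) y∈))

  ascending-sorted : ∀ {m} (S : Subset m) → Linked _<_ (ascending S)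
  ascending-sorted []          = []
  ascending-sorted (true  ∷ S) =
    Ascending.linked-∷ (map-suc-above-1 S ascending (occ-ascending S)) (Linked.map⁺ (Linked.map s≤s (ascending-sorted S)))
  ascending-sorted (false ∷ S) = Linked.map⁺ (Linked.map s≤s (ascending-sorted S))

  descending-sorted : ∀ {m} (S : Subset m) → Linked _>_ (descending S)
  descending-sorted []          = []
  descending-sorted (true  ∷ S) =
    Descending.linked-∷ʳ (Linked.map⁺ (Linked.map s≤s (descending-sorted S))) (map-suc-above-1 S descending (occ-descending S))
  descending-sorted (false ∷ S) = Linked.map⁺ (Linked.map s≤s (descending-sorted S))

  bit>0 : ∀ {b} → 0 < bit b → b ≡ true
  bit>0 {true} _ = refl

  ∈ₒ⇒bit-true : ∀ {x} xs {b} → occ x xs ≡ bit b → x ∈ₒ xs → b ≡ true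
  ∈ₒ⇒bit-true _ occ≡ x∈ = bit>0 (subst (0 <_) occ≡ x∈)

  letters : ∀ m → List ℕ → Subset m
  letters zero    w = []
  letters (suc m) w = nonzero (occ 1 w) ∷ letters m (map ℕ.pred w)

  hasLetter-letters : ∀ m w x → hasLetter (letters m w) x ≡ inRange m x ∧ nonzero (occ x w)
  hasLetter-letters zero    w zero          = refl
  hasLetter-letters zero    w (suc x)       = refl
  hasLetter-letters (suc m) w zero          = refl
  hasLetter-letters (suc m) w (suc zero)    = refl
  hasLetter-letters (suc m) w (suc (suc x)) =
    trans (hasLetter-letters m (map ℕ.pred w) (suc x)) (cong (λ c → inRange m (suc x) ∧ nonzero c) (occ-suc-map-pred x w))

  Distinct : ℕ → List ℕ → Set
  Distinct m w = ∀ x → occ x w ≤ bit (inRange m x)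

  bit-hasLetter-letters : ∀ m w → Distinct m w → ∀ x → bit (hasLetter (letters m w) x) ≡ occ x w
  bit-hasLetter-letters m w distinct x rewrite hasLetter-letters m w x = bit-∧-nonzero _ _ (distinct x)

  range≡ascending-full : ∀ m → range m ≡ ascending (full {m})
  range≡ascending-full zero    = refl
  range≡ascending-full (suc m) = cong (1 ∷_) (begin
    map suc (List.applyUpTo suc m)    ≡⟨ cong (map suc) (List.map-applyUpTo id suc m) ⟨
    map suc (range m)                 ≡⟨ cong (map suc) (range≡ascending-full m) ⟩
    map suc (ascending (full {m}))    ∎)
    where open ≡-Reasoning

  occ-range : ∀ m x → occ x (range m) ≡ bit (inRange m x)
  occ-range m x rewrite range≡ascending-full m = occ-ascending full x

  nonEmpty : ∀ {m} → Subset m → Bool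
  nonEmpty []      = false
  nonEmpty (b ∷ S) = b ∨ nonEmpty S

  maxIndex : ∀ {m} → Subset m → ℕ
  maxIndex []      = 0
  maxIndex (b ∷ S) = if nonEmpty S then suc (maxIndex S) else 0

  maxLetter : ∀ {m} → Subset m → ℕ
  maxLetter S = suc (maxIndex S)

  dropMax : ∀ {m} → Subset m → Subset m
  dropMax []      = []
  dropMax (b ∷ S) = if nonEmpty S then b ∷ dropMax S else false ∷ S

  hasIndex⇒nonEmpty : ∀ {m} (S : Subset m) i → hasIndex S i ≡ true → nonEmpty S ≡ true
  hasIndex⇒nonEmpty (true ∷ S) zero    _  = refl
  hasIndex⇒nonEmpty (b    ∷ S) (suc i) ∈S rewrite hasIndex⇒nonEmpty S i ∈S = Bool.∨-zeroʳ b

  hasLetter⇒nonEmpty : ∀ {m} (S : Subset m) x → hasLetter S x ≡ true → nonEmpty S ≡ true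
  hasLetter⇒nonEmpty S (suc i) ∈S = hasIndex⇒nonEmpty S i ∈S

  empty⇒∣∣≡0 : ∀ {m} (S : Subset m) → nonEmpty S ≡ false → ∣ S ∣ ≡ 0
  empty⇒∣∣≡0 []          _     = refl
  empty⇒∣∣≡0 (false ∷ S) empty = empty⇒∣∣≡0 S empty

  hasIndex-maxIndex : ∀ {m} (S : Subset m) → nonEmpty S ≡ true → hasIndex S (maxIndex S) ≡ true
  hasIndex-maxIndex (b ∷ S) nonempty with nonEmpty S in eq
  ... | true  = hasIndex-maxIndex S eq
  ... | false = trans (sym (Bool.∨-identityʳ b)) nonempty

  ≤-maxIndex : ∀ {m} (S : Subset m) i → hasIndex S i ≡ true → i ≤ maxIndex S
  ≤-maxIndex (b ∷ S) zero    _  = z≤n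
  ≤-maxIndex (b ∷ S) (suc i) ∈S with nonEmpty S in eq
  ... | true  = s≤s (≤-maxIndex S i ∈S)
  ... | false with () ← trans (sym (hasIndex⇒nonEmpty S i ∈S)) eq

  hasIndex-dropMax : ∀ {m} (S : Subset m) → nonEmpty S ≡ true →
                     ∀ i → hasIndex (dropMax S) i ≡ hasIndex S i ∧ not (i ≡ᵇ maxIndex S)
  hasIndex-dropMax (b ∷ S) nonempty i with nonEmpty S in eq
  hasIndex-dropMax (b ∷ S) nonempty zero    | true  = sym (Bool.∧-identityʳ b)
  hasIndex-dropMax (b ∷ S) nonempty (suc i) | true  = hasIndex-dropMax S eq i
  hasIndex-dropMax (b ∷ S) nonempty zero    | false rewrite trans (sym (Bool.∨-identityʳ b)) nonempty = refl
  hasIndex-dropMax (b ∷ S) nonempty (suc i) | false = sym (Bool.∧-identityʳ _)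

  ∣dropMax∣ : ∀ {m} (S : Subset m) → nonEmpty S ≡ true → suc ∣ dropMax S ∣ ≡ ∣ S ∣
  ∣dropMax∣ (b ∷ S) nonempty with nonEmpty S in eq
  ... | true  = begin
    suc ∣ b ∷ dropMax S ∣       ≡⟨ cong suc (∣∷∣ b (dropMax S)) ⟩
    suc (bit b + ∣ dropMax S ∣) ≡⟨ ℕ.+-suc (bit b) _ ⟨
    bit b + suc ∣ dropMax S ∣   ≡⟨ cong (bit b +_) (∣dropMax∣ S eq) ⟩
    bit b + ∣ S ∣               ≡⟨ ∣∷∣ b S ⟨
    ∣ b ∷ S ∣                   ∎
    where open ≡-Reasoning
  ... | false rewrite trans (sym (Bool.∨-identityʳ b)) nonempty = refl

  hasLetter-maxLetter : ∀ {m} (S : Subset m) → nonEmpty S ≡ true → hasLetter S (maxLetter S) ≡ true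
  hasLetter-maxLetter = hasIndex-maxIndex

  ≤-maxLetter : ∀ {m} (S : Subset m) x → hasLetter S x ≡ true → x ≤ maxLetter S
  ≤-maxLetter S (suc i) ∈S = s≤s (≤-maxIndex S i ∈S)

  hasLetter-dropMax : ∀ {m} (S : Subset m) → nonEmpty S ≡ true →
                      ∀ x → hasLetter (dropMax S) x ≡ hasLetter S x ∧ not (x ≡ᵇ maxLetter S)
  hasLetter-dropMax S nonempty zero    = refl
  hasLetter-dropMax S nonempty (suc i) = hasIndex-dropMax S nonempty i

  <-maxLetter : ∀ {m} (S : Subset m) → nonEmpty S ≡ true → ∀ x → hasLetter (dropMax S) x ≡ true → x < maxLetter S
  <-maxLetter S nonempty x ∈dropMax
    with hasLetter S x in ∈S | x ≡ᵇ maxLetter S in x≡max | trans (sym (hasLetter-dropMax S nonempty x)) ∈dropMax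
  ... | true | false | _ = ℕ.≤∧≢⇒< (≤-maxLetter S x ∈S) x≢max
    where
    x≢max : x ≢ maxLetter S
    x≢max refl with () ← trans (sym (≡ᵇ-refl x)) x≡max

  hasIndex-─ : ∀ {m} (S R : Subset m) i → hasIndex (S ─ R) i ≡ hasIndex S i ∧ not (hasIndex R i)
  hasIndex-─ []      []          i       = refl
  hasIndex-─ (b ∷ S) (true  ∷ R) zero    = sym (Bool.∧-zeroʳ b)
  hasIndex-─ (b ∷ S) (false ∷ R) zero    = sym (Bool.∧-identityʳ b)
  hasIndex-─ (b ∷ S) (true  ∷ R) (suc i) = hasIndex-─ S R i
  hasIndex-─ (b ∷ S) (false ∷ R) (suc i) = hasIndex-─ S R i

  hasLetter-─ : ∀ {m} (S R : Subset m) x → hasLetter (S ─ R) x ≡ hasLetter S x ∧ not (hasLetter R x)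
  hasLetter-─ S R zero    = refl
  hasLetter-─ S R (suc i) = hasIndex-─ S R i

  infix 4 _⊑_
  _⊑_ : ∀ {m} → Subset m → Subset m → Set
  _⊑_ = Pointwise Bool._≤_

  ⊑⇒hasIndex : ∀ {m} {R S : Subset m} → R ⊑ S → ∀ i → hasIndex R i ≡ true → hasIndex S i ≡ true
  ⊑⇒hasIndex (f≤t ∷ _)   zero    _  = refl
  ⊑⇒hasIndex (b≤b ∷ _)   zero    ∈R = ∈R
  ⊑⇒hasIndex (_   ∷ R⊑S) (suc i) ∈R = ⊑⇒hasIndex R⊑S i ∈R

  ⊑⇒hasLetter : ∀ {m} {R S : Subset m} → R ⊑ S → ∀ x → hasLetter R x ≡ true → hasLetter S x ≡ true
  ⊑⇒hasLetter R⊑S (suc i) = ⊑⇒hasIndex R⊑S i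

  hasIndex⇒⊑ : ∀ {m} (R S : Subset m) → (∀ i → hasIndex R i ≡ true → hasIndex S i ≡ true) → R ⊑ S
  hasIndex⇒⊑ []      []      _   = []
  hasIndex⇒⊑ (a ∷ R) (b ∷ S) R⇒S = ≤-head a b (R⇒S 0) ∷ hasIndex⇒⊑ R S (R⇒S ∘ suc)
    where
    ≤-head : ∀ a b → (a ≡ true → b ≡ true) → a Bool.≤ b
    ≤-head false false _ = b≤b
    ≤-head false true  _ = f≤t
    ≤-head true  true  _ = b≤b
    ≤-head true  false a⇒b with () ← a⇒b refl

  hasLetter⇒⊑ : ∀ {m} (R S : Subset m) → (∀ x → hasLetter R x ≡ true → hasLetter S x ≡ true) → R ⊑ S
  hasLetter⇒⊑ R S R⇒S = hasIndex⇒⊑ R S (R⇒S ∘ suc)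

  ∣─∣+∣∣ : ∀ {m} {R S : Subset m} → R ⊑ S → ∣ S ─ R ∣ + ∣ R ∣ ≡ ∣ S ∣
  ∣─∣+∣∣ []                   = refl
  ∣─∣+∣∣ (f≤t         ∷ R⊑S) = cong suc (∣─∣+∣∣ R⊑S)
  ∣─∣+∣∣ (b≤b {true}  ∷ R⊑S) = trans (ℕ.+-suc _ _) (cong suc (∣─∣+∣∣ R⊑S))
  ∣─∣+∣∣ (b≤b {false} ∷ R⊑S) = ∣─∣+∣∣ R⊑S

  letters-listing : ∀ {m} (S : Subset m) w → (∀ x → occ x w ≡ bit (hasLetter S x)) → letters m w ≡ S
  letters-listing {m} S w occ-w = hasLetter-ext _ _ λ x → begin
    hasLetter (letters m w) x               ≡⟨ hasLetter-letters m w x ⟩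
    inRange m x ∧ nonzero (occ x w)         ≡⟨ cong (λ c → inRange m x ∧ nonzero c) (occ-w x) ⟩
    inRange m x ∧ nonzero (bit (hasLetter S x)) ≡⟨ cong (inRange m x ∧_) (nonzero-bit _) ⟩
    inRange m x ∧ hasLetter S x             ≡⟨ inRange-∧-hasLetter S x ⟩
    hasLetter S x                           ∎
    where open ≡-Reasoning

  wordOf : ∀ {m} → Subset m → Subset m → List ℕ
  wordOf S R = ascending (dropMax S ─ R) ++ maxLetter S ∷ descending R

  descent : List ℕ → List ℕ
  descent []          = []
  descent (x ∷ [])    = []
  descent (x ∷ y ∷ w) = if x <ᵇ y then descent (y ∷ w) else y ∷ w

  <⇒<ᵇ-true : ∀ {x y} → x < y → (x <ᵇ y) ≡ true
  <⇒<ᵇ-true x<y = Equivalence.to Bool.T-≡ (ℕ.<⇒<ᵇ x<y)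

  >⇒<ᵇ-false : ∀ {x y} → y < x → (x <ᵇ y) ≡ false
  >⇒<ᵇ-false {x} {y} y<x with x <ᵇ y in eq
  ... | false = refl
  ... | true  = ⊥-elim (ℕ.<-asym y<x (ℕ.<ᵇ⇒< x y (Equivalence.from Bool.T-≡ eq)))

  descent-< : ∀ {x y} w → x < y → descent (x ∷ y ∷ w) ≡ descent (y ∷ w)
  descent-< {x} {y} w x<y rewrite <⇒<ᵇ-true x<y = refl

  descent-> : ∀ {x y} w → y < x → descent (x ∷ y ∷ w) ≡ y ∷ w
  descent-> {x} {y} w y<x rewrite >⇒<ᵇ-false y<x = refl

  descent-unimodal : ∀ as p ds → Linked _<_ (as ++ [ p ]) → Linked _>_ (p ∷ ds) → descent (as ++ p ∷ ds) ≡ ds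
  descent-unimodal []            p []       _           _         = refl
  descent-unimodal []            p (d ∷ ds) _           (d<p ∷ _) = descent-> ds d<p
  descent-unimodal (a ∷ [])      p ds       (a<p ∷ _)   l₂ = trans (descent-< ds a<p) (descent-unimodal [] p ds [-] l₂)
  descent-unimodal (a ∷ a′ ∷ as) p ds       (a<a′ ∷ l₁) l₂ =
    trans (descent-< (as ++ p ∷ ds) a<a′) (descent-unimodal (a′ ∷ as) p ds l₁ l₂)

  bit-peak-partition : ∀ s e r → (r ≡ true → s ∧ not e ≡ true) → (e ≡ true → s ≡ true) →
                       bit ((s ∧ not e) ∧ not r) + (bit e + bit r) ≡ bit s
  bit-peak-partition true  true  true  r⇒ _  with () ← r⇒ refl
  bit-peak-partition true  true  false _  _  = refl
  bit-peak-partition true  false true  _  _  = refl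
  bit-peak-partition true  false false _  _  = refl
  bit-peak-partition false e     true  r⇒ _  with () ← r⇒ refl
  bit-peak-partition false true  false _  e⇒ with () ← e⇒ refl
  bit-peak-partition false false false _  _  = refl

  module WordOf {m} (S R : Subset m) (nonempty : nonEmpty S ≡ true) (R⊑ : R ⊑ dropMax S) where

    ascent-linked : Linked _<_ (ascending (dropMax S ─ R) ++ [ maxLetter S ])
    ascent-linked = Ascending.linked-∷ʳ (ascending-sorted (dropMax S ─ R)) λ x x∈ →
      <-maxLetter S nonempty x (Bool.∧-conicalˡ _ _
        (trans (sym (hasLetter-─ (dropMax S) R x)) (∈ₒ⇒bit-true (ascending (dropMax S ─ R)) (occ-ascending (dropMax S ─ R) x) x∈)))

    descent-linked : Linked _>_ (maxLetter S ∷ descending R)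
    descent-linked = Descending.linked-∷ (λ x x∈ →
      <-maxLetter S nonempty x (⊑⇒hasLetter R⊑ x (∈ₒ⇒bit-true (descending R) (occ-descending R x) x∈))) (descending-sorted R)

    wordOf-unimodal : Unimodal (wordOf S R)
    wordOf-unimodal = ascending (dropMax S ─ R) , maxLetter S , descending R , refl , ascent-linked , descent-linked

    descent-wordOf : descent (wordOf S R) ≡ descending R
    descent-wordOf = descent-unimodal (ascending (dropMax S ─ R)) (maxLetter S) (descending R) ascent-linked descent-linked

    occ-wordOf : ∀ x → occ x (wordOf S R) ≡ bit (hasLetter S x)
    occ-wordOf x = begin
      occ x (wordOf S R)
        ≡⟨ occ-++ x (ascending (dropMax S ─ R)) (maxLetter S ∷ descending R) ⟩
      occ x (ascending (dropMax S ─ R)) + (bit (x ≡ᵇ maxLetter S) + occ x (descending R))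
        ≡⟨ cong₂ (λ a d → a + (bit (x ≡ᵇ maxLetter S) + d)) occ-ascent (occ-descending R x) ⟩
      bit ((s ∧ not e) ∧ not r) + (bit e + bit r)
        ≡⟨ bit-peak-partition s e r (λ r≡true → trans (sym (hasLetter-dropMax S nonempty x)) (⊑⇒hasLetter R⊑ x r≡true))
             (λ e≡true → subst (λ y → hasLetter S y ≡ true) (sym (≡ᵇ⇒≡ x (maxLetter S) e≡true)) (hasLetter-maxLetter S nonempty)) ⟩
      bit s ∎
      where
      open ≡-Reasoning
      s = hasLetter S x
      e = x ≡ᵇ maxLetter S
      r = hasLetter R x
      occ-ascent : occ x (ascending (dropMax S ─ R)) ≡ bit ((s ∧ not e) ∧ not r)
      occ-ascent = trans (occ-ascending (dropMax S ─ R) x)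
        (cong bit (trans (hasLetter-─ (dropMax S) R x) (cong (_∧ not r) (hasLetter-dropMax S nonempty x))))

    length-wordOf : length (wordOf S R) ≡ ∣ S ∣
    length-wordOf = begin
      length (wordOf S R)                                              ≡⟨ List.length-++ (ascending (dropMax S ─ R)) ⟩
      length (ascending (dropMax S ─ R)) + suc (length (descending R))
        ≡⟨ cong₂ (λ a d → a + suc d) (length-ascending (dropMax S ─ R)) (length-descending R) ⟩
      ∣ dropMax S ─ R ∣ + suc ∣ R ∣                                    ≡⟨ ℕ.+-suc _ _ ⟩
      suc (∣ dropMax S ─ R ∣ + ∣ R ∣)                                  ≡⟨ cong suc (∣─∣+∣∣ R⊑) ⟩
      suc ∣ dropMax S ∣                                                ≡⟨ ∣dropMax∣ S nonempty ⟩
      ∣ S ∣                                                            ∎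
      where open ≡-Reasoning

    letters-wordOf : letters m (wordOf S R) ≡ S
    letters-wordOf = letters-listing S (wordOf S R) occ-wordOf

    letters-descent-wordOf : letters m (descent (wordOf S R)) ≡ R
    letters-descent-wordOf = trans (cong (letters m) descent-wordOf) (letters-listing R (descending R) (occ-descending R))

  bit-true⇒∈ₒ : ∀ {x} xs {b} → occ x xs ≡ bit b → b ≡ true → x ∈ₒ xs
  bit-true⇒∈ₒ _ occ≡ refl = subst (0 <_) (sym occ≡) (s≤s z≤n)

  module Decode (m : ℕ) (as : List ℕ) (p : ℕ) (ds : List ℕ) (distinct : Distinct m (as ++ p ∷ ds))
                (ascent : Linked _<_ (as ++ [ p ])) (descent′ : Linked _>_ (p ∷ ds)) where

    w : List ℕ
    w = as ++ p ∷ ds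

    S R : Subset m
    S = letters m w
    R = letters m (descent w)

    occ-w : ∀ x → occ x w ≡ occ x as + (bit (x ≡ᵇ p) + occ x ds)
    occ-w x = occ-++ x as (p ∷ ds)

    occ-ds≤occ-w : ∀ x → occ x ds ≤ occ x w
    occ-ds≤occ-w x rewrite occ-w x = ℕ.≤-trans (ℕ.m≤n+m (occ x ds) (bit (x ≡ᵇ p))) (ℕ.m≤n+m _ (occ x as))

    bit-S : ∀ x → bit (hasLetter S x) ≡ occ x w
    bit-S = bit-hasLetter-letters m w distinct

    bit-R : ∀ x → bit (hasLetter R x) ≡ occ x ds
    bit-R x rewrite descent-unimodal as p ds ascent descent′ =
      bit-hasLetter-letters m ds (λ y → ℕ.≤-trans (occ-ds≤occ-w y) (distinct y)) x

    p∈w : p ∈ₒ w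
    p∈w = ∈ₒ-++ʳ p as (p ∷ ds) (∈ₒ-head p ds)

    S-nonEmpty : nonEmpty S ≡ true
    S-nonEmpty = hasLetter⇒nonEmpty S p (∈ₒ⇒bit-true w (sym (bit-S p)) p∈w)

    ≤-peak : ∀ x → x ∈ₒ w → x ≤ p
    ≤-peak x x∈w with occ x as in occ-as | occ-w x
    ... | suc _ | _ = ℕ.<⇒≤ (Ascending.linked-last ascent (subst (0 <_) (sym occ-as) (s≤s z≤n)))
    ... | zero  | occ≡ with x ≡ᵇ p in x≡p
    ...   | true  = ℕ.≤-reflexive (≡ᵇ⇒≡ x p x≡p)
    ...   | false = ℕ.<⇒≤ (Descending.linked-head descent′ (subst (0 <_) occ≡ x∈w))

    maxLetter≡peak : maxLetter S ≡ p
    maxLetter≡peak = ℕ.≤-antisym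
      (≤-peak (maxLetter S) (bit-true⇒∈ₒ w (sym (bit-S (maxLetter S))) (hasLetter-maxLetter S S-nonEmpty)))
      (≤-maxLetter S p (∈ₒ⇒bit-true w (sym (bit-S p)) p∈w))

    R⊑dropMax-S : R ⊑ dropMax S
    R⊑dropMax-S = hasLetter⇒⊑ R (dropMax S) λ x x∈R →
      let x∈ds = bit-true⇒∈ₒ ds (sym (bit-R x)) x∈R
          x<p  = Descending.linked-head descent′ x∈ds
          x∈S  = ∈ₒ⇒bit-true w (sym (bit-S x)) (ℕ.<-≤-trans x∈ds (occ-ds≤occ-w x))
      in begin
        hasLetter (dropMax S) x                   ≡⟨ hasLetter-dropMax S S-nonEmpty x ⟩
        hasLetter S x ∧ not (x ≡ᵇ maxLetter S)    ≡⟨ cong₂ (λ s y → s ∧ not (x ≡ᵇ y)) x∈S maxLetter≡peak ⟩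
        not (x ≡ᵇ p)                              ≡⟨ cong not (≢⇒≡ᵇ-false x p (ℕ.<⇒≢ x<p)) ⟩
        true                                      ∎
      where open ≡-Reasoning

    open WordOf S R S-nonEmpty R⊑dropMax-S

    descending-R : descending R ≡ ds
    descending-R = Descending.linked-occ-unique (descending-sorted R) (Linked.tail descent′)
      (λ x → trans (occ-descending R x) (bit-R x))

    -- Both wordOf S R and w have the multiplicities of S and share their peak and descent,
    -- so their ascents have the same multiplicities too.
    ascending-rest : ascending (dropMax S ─ R) ≡ as
    ascending-rest = Ascending.linked-occ-unique (ascending-sorted (dropMax S ─ R)) (Ascending.linked-++⁻ˡ ascent)
      λ x → ℕ.+-cancelʳ-≡ _ _ _ (begin
        occ x (ascending (dropMax S ─ R)) + (bit (x ≡ᵇ p) + occ x ds)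
          ≡⟨ cong₂ (λ y d → occ x (ascending (dropMax S ─ R)) + (bit (x ≡ᵇ y) + occ x d))
                   (sym maxLetter≡peak) (sym descending-R) ⟩
        occ x (ascending (dropMax S ─ R)) + occ x (maxLetter S ∷ descending R)
          ≡⟨ occ-++ x (ascending (dropMax S ─ R)) (maxLetter S ∷ descending R) ⟨
        occ x (wordOf S R)                        ≡⟨ occ-wordOf x ⟩
        bit (hasLetter S x)                       ≡⟨ bit-S x ⟩
        occ x w                                   ≡⟨ occ-w x ⟩
        occ x as + (bit (x ≡ᵇ p) + occ x ds)      ∎)
      where open ≡-Reasoning

    wordOf-letters : wordOf S R ≡ w
    wordOf-letters = cong₂ _++_ ascending-rest (cong₂ _∷_ maxLetter≡peak descending-R)

    ∣letters∣≡length : ∣ S ∣ ≡ length w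
    ∣letters∣≡length = trans (sym length-wordOf) (cong length wordOf-letters)

  module _ {m w} (distinct : Distinct m w) where

    wordOf-letters : Unimodal w → wordOf (letters m w) (letters m (descent w)) ≡ w
    wordOf-letters (as , p , ds , refl , ascent , descent′) = Decode.wordOf-letters m as p ds distinct ascent descent′

    letters-descent⊑dropMax : Unimodal w → letters m (descent w) ⊑ dropMax (letters m w)
    letters-descent⊑dropMax (as , p , ds , refl , ascent , descent′) = Decode.R⊑dropMax-S m as p ds distinct ascent descent′

    ∣letters∣≡length : Unimodal w → ∣ letters m w ∣ ≡ length w
    ∣letters∣≡length (as , p , ds , refl , ascent , descent′) = Decode.∣letters∣≡length m as p ds distinct ascent descent′


module Labellings where

  open Enumerations
  open UnimodalWords
  open import Defs using (Word; range; Unimodal; OddUnimodal; OddComp; oc)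
  open import Data.Nat as ℕ using (ℕ; zero; suc; _+_; _*_; _∸_; _^_; _≤_; _<_; s≤s; z≤n; _≡ᵇ_; _%_)
  import Data.Nat.Properties as ℕ
  open import Data.Nat.Tactic.RingSolver using (solve-∀)
  open import Data.Bool as Bool using (Bool; true; false; _∧_; _∨_; b≤b)
  import Data.Bool.Properties as Bool
  open import Data.List as List using (List; []; _∷_; _++_; concat)
  import Data.List.Properties as List
  open import Data.List.Relation.Unary.All as All using (All; []; _∷_)
  open import Data.List.Relation.Binary.Permutation.Propositional
    using (_↭_; refl; prep; swap; trans; ↭-sym)
  open import Data.List.Relation.Binary.Permutation.Propositional.Properties using (shift; ↭-length)
  open import Data.Vec as Vec using (Vec; []; _∷_; zipWith; lookup; toList)
  import Data.Vec.Properties as Vec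
  open import Data.Vec.Relation.Unary.All.Properties using (toList⁻; lookup⁺)
  open import Data.Vec.Relation.Binary.Pointwise.Inductive as Pointwise using (Pointwise; []; _∷_)
  open import Data.Fin using (Fin; zero; suc)
  import Data.Fin.Properties as Fin
  open import Data.Fin.Subset using (Subset; ∣_∣; _∩_; ⋃) renaming (⊤ to full; ⊥ to ∅)
  open import Data.Empty using (⊥-elim; ⊥-elim-irr)
  open import Data.Unit using (tt)
  open import Data.Product using (Σ; _,_; proj₁; proj₂)
  open import Data.Sum using (inj₁; inj₂)
  open import Function using (_∘_; const; _↔_; mk↔ₛ′)
  open import Relation.Nullary using (¬_)
  open import Function.Properties.Inverse using (↔-sym)
  open import Relation.Nullary.Decidable using (recompute)
  open import Relation.Binary.PropositionalEquality as ≡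
    using (_≡_; _≢_; cong; cong₂; subst; module ≡-Reasoning)

  ↭⇒occ : ∀ {xs ys} → xs ↭ ys → ∀ x → occ x xs ≡ occ x ys
  ↭⇒occ refl         x = ≡.refl
  ↭⇒occ (prep y p)   x = cong (bit (x ≡ᵇ y) +_) (↭⇒occ p x)
  ↭⇒occ (swap y z p) x =
    ≡.trans (cong (λ c → bit (x ≡ᵇ y) + (bit (x ≡ᵇ z) + c)) (↭⇒occ p x)) (exchange (bit (x ≡ᵇ y)) (bit (x ≡ᵇ z)) _)
    where
    exchange : ∀ a b c → a + (b + c) ≡ b + (a + c)
    exchange = solve-∀
  ↭⇒occ (trans p q)  x = ≡.trans (↭⇒occ p x) (↭⇒occ q x)

  ∈ₒ⇒split : ∀ x ys → x ∈ₒ ys → Σ (List ℕ) λ ys₁ → Σ (List ℕ) λ ys₂ → ys ≡ ys₁ ++ x ∷ ys₂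
  ∈ₒ⇒split x (y ∷ ys) x∈ with ∈ₒ-∷ x y ys x∈
  ... | inj₁ ≡.refl = [] , ys , ≡.refl
  ... | inj₂ x∈ys with ∈ₒ⇒split x ys x∈ys
  ...   | ys₁ , ys₂ , ys≡ = y ∷ ys₁ , ys₂ , cong (y ∷_) ys≡

  occ⇒↭ : ∀ xs ys → (∀ x → occ x xs ≡ occ x ys) → xs ↭ ys
  occ⇒↭ []       []       _    = refl
  occ⇒↭ []       (y ∷ ys) occ≡ with () ← subst (0 <_) (≡.sym (occ≡ y)) (∈ₒ-head y ys)
  occ⇒↭ (x ∷ xs) ys       occ≡ with ∈ₒ⇒split x ys (subst (0 <_) (occ≡ x) (∈ₒ-head x xs))
  ... | ys₁ , ys₂ , ≡.refl = trans (prep x (occ⇒↭ xs (ys₁ ++ ys₂) occ-rest)) (↭-sym (shift x ys₁ ys₂))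
    where
    occ-rest : ∀ z → occ z xs ≡ occ z (ys₁ ++ ys₂)
    occ-rest z = ℕ.+-cancelˡ-≡ (bit (z ≡ᵇ x)) _ _ (begin
      bit (z ≡ᵇ x) + occ z xs                   ≡⟨ occ≡ z ⟩
      occ z (ys₁ ++ x ∷ ys₂)                    ≡⟨ occ-++ z ys₁ (x ∷ ys₂) ⟩
      occ z ys₁ + (bit (z ≡ᵇ x) + occ z ys₂)    ≡⟨ exchange (occ z ys₁) (bit (z ≡ᵇ x)) (occ z ys₂) ⟩
      bit (z ≡ᵇ x) + (occ z ys₁ + occ z ys₂)    ≡⟨ cong (bit (z ≡ᵇ x) +_) (occ-++ z ys₁ ys₂) ⟨
      bit (z ≡ᵇ x) + occ z (ys₁ ++ ys₂)         ∎)
      where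
      open ≡-Reasoning
      exchange : ∀ a b c → a + (b + c) ≡ b + (a + c)
      exchange = solve-∀

  occSum : ∀ {j} → Vec Word j → ℕ → ℕ
  occSum []       x = 0
  occSum (w ∷ ws) x = occ x w + occSum ws x

  occ-concat : ∀ {j} (ws : Vec Word j) x → occ x (concat (toList ws)) ≡ occSum ws x
  occ-concat []       x = ≡.refl
  occ-concat (w ∷ ws) x = ≡.trans (occ-++ x w (concat (toList ws))) (cong (occ x w +_) (occ-concat ws x))

  concat↭range⇒occSum : ∀ {m j} (ws : Vec Word j) → concat (toList ws) ↭ range m → ∀ x → occSum ws x ≡ bit (inRange m x)
  concat↭range⇒occSum {m} ws ws↭ x = ≡.trans (≡.sym (occ-concat ws x)) (≡.trans (↭⇒occ ws↭ x) (occ-range m x))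

  occSum⇒Distinct : ∀ {m j} (ws : Vec Word j) → (∀ x → occSum ws x ≤ bit (inRange m x)) → All (Distinct m) (toList ws)
  occSum⇒Distinct []       _      = []
  occSum⇒Distinct (w ∷ ws) occ≤1 =
    (λ x → ℕ.≤-trans (ℕ.m≤m+n _ _) (occ≤1 x)) ∷ occSum⇒Distinct ws (λ x → ℕ.≤-trans (ℕ.m≤n+m _ _) (occ≤1 x))

  coverCount : ∀ {m j} → Vec (Subset m) j → ℕ → ℕ
  coverCount []       x = 0
  coverCount (S ∷ Ss) x = bit (hasLetter S x) + coverCount Ss x

  Partition : ∀ {m j} → Vec (Subset m) j → Set
  Partition {m} Ss = ∀ x → coverCount Ss x ≡ bit (inRange m x)

  anyHasLetter : ∀ {m j} → Vec (Subset m) j → ℕ → Bool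
  anyHasLetter []       x = false
  anyHasLetter (S ∷ Ss) x = hasLetter S x ∨ anyHasLetter Ss x

  hasLetter-⋃ : ∀ {m j} (Ss : Vec (Subset m) j) x → hasLetter (⋃ (toList Ss)) x ≡ anyHasLetter Ss x
  hasLetter-⋃ {m} []       x = hasLetter-∅ m x
  hasLetter-⋃     (S ∷ Ss) x =
    ≡.trans (hasLetter-zipWith _∨_ ≡.refl S (⋃ (toList Ss)) x) (cong (hasLetter S x ∨_) (hasLetter-⋃ Ss x))

  hasLetter-∩ : ∀ {m} (S S′ : Subset m) x → hasLetter (S ∩ S′) x ≡ hasLetter S x ∧ hasLetter S′ x
  hasLetter-∩ = hasLetter-zipWith _∧_ ≡.refl

  anyHasLetter≡nonzero : ∀ {m j} (Ss : Vec (Subset m) j) x → anyHasLetter Ss x ≡ nonzero (coverCount Ss x)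
  anyHasLetter≡nonzero []       x = ≡.refl
  anyHasLetter≡nonzero (S ∷ Ss) x with hasLetter S x
  ... | true  = ≡.refl
  ... | false = anyHasLetter≡nonzero Ss x

  coverCount-absent : ∀ {m j} (Ss : Vec (Subset m) j) x → (∀ k → hasLetter (lookup Ss k) x ≡ false) → coverCount Ss x ≡ 0
  coverCount-absent []       x _      = ≡.refl
  coverCount-absent (S ∷ Ss) x absent rewrite absent zero = coverCount-absent Ss x (absent ∘ suc)

  coverCount-disjoint : ∀ {m j} (Ss : Vec (Subset m) j) x →
                        (∀ i k → i ≢ k → hasLetter (lookup Ss i) x ∧ hasLetter (lookup Ss k) x ≡ false) →
                        coverCount Ss x ≡ bit (anyHasLetter Ss x)
  coverCount-disjoint []       x _        = ≡.refl
  coverCount-disjoint (S ∷ Ss) x disjoint with hasLetter S x in x∈S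
  ... | true  = cong suc (coverCount-absent Ss x λ k →
                  ≡.trans (cong (_∧ hasLetter (lookup Ss k) x) (≡.sym x∈S)) (disjoint zero (suc k) λ ()))
  ... | false = coverCount-disjoint Ss x λ i k i≢k → disjoint (suc i) (suc k) (i≢k ∘ Fin.suc-injective)

  coverCount-positive : ∀ {m j} (Ss : Vec (Subset m) j) x k → hasLetter (lookup Ss k) x ≡ true → 1 ≤ coverCount Ss x
  coverCount-positive (S ∷ Ss) x zero    x∈ rewrite x∈ = s≤s z≤n
  coverCount-positive (S ∷ Ss) x (suc k) x∈ = ℕ.≤-trans (coverCount-positive Ss x k x∈) (ℕ.m≤n+m _ _)

  coverCount≥2 : ∀ {m j} (Ss : Vec (Subset m) j) x i k → i ≢ k →
                 hasLetter (lookup Ss i) x ≡ true → hasLetter (lookup Ss k) x ≡ true → 2 ≤ coverCount Ss x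
  coverCount≥2 (S ∷ Ss) x zero    zero    i≢k _   _   = ⊥-elim (i≢k ≡.refl)
  coverCount≥2 (S ∷ Ss) x zero    (suc k) _   x∈i x∈k rewrite x∈i = s≤s (coverCount-positive Ss x k x∈k)
  coverCount≥2 (S ∷ Ss) x (suc i) zero    _   x∈i x∈k rewrite x∈k = s≤s (coverCount-positive Ss x i x∈i)
  coverCount≥2 (S ∷ Ss) x (suc i) (suc k) i≢k x∈i x∈k =
    ℕ.≤-trans (coverCount≥2 Ss x i k (i≢k ∘ cong suc) x∈i x∈k) (ℕ.m≤n+m _ _)

  disjoint-cover⇒Partition : ∀ {m j} (Ss : Vec (Subset m) j) →
    (∀ i k → i ≢ k → lookup Ss i ∩ lookup Ss k ≡ ∅) → ⋃ (toList Ss) ≡ full → Partition Ss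
  disjoint-cover⇒Partition {m} Ss disjoint cover x = ≡.trans
    (coverCount-disjoint Ss x λ i k i≢k → begin
      hasLetter (lookup Ss i) x ∧ hasLetter (lookup Ss k) x ≡⟨ hasLetter-∩ (lookup Ss i) (lookup Ss k) x ⟨
      hasLetter (lookup Ss i ∩ lookup Ss k) x               ≡⟨ cong (λ S → hasLetter S x) (disjoint i k i≢k) ⟩
      hasLetter ∅ x                                         ≡⟨ hasLetter-∅ m x ⟩
      false                                                 ∎)
    (cong bit (≡.trans (≡.sym (hasLetter-⋃ Ss x)) (cong (λ S → hasLetter S x) cover)))
    where open ≡-Reasoning

  Partition⇒disjoint : ∀ {m j} (Ss : Vec (Subset m) j) → Partition Ss → ∀ i k → i ≢ k → lookup Ss i ∩ lookup Ss k ≡ ∅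
  Partition⇒disjoint {m} Ss partition i k i≢k = hasLetter-ext _ _ λ x →
    ≡.trans (hasLetter-∩ (lookup Ss i) (lookup Ss k) x) (≡.trans (not-both x) (≡.sym (hasLetter-∅ m x)))
    where
    not-both : ∀ x → hasLetter (lookup Ss i) x ∧ hasLetter (lookup Ss k) x ≡ false
    not-both x with hasLetter (lookup Ss i) x in x∈i | hasLetter (lookup Ss k) x in x∈k
    ... | true  | true  = ⊥-elim (ℕ.<-irrefl ≡.refl
            (ℕ.≤-trans (coverCount≥2 Ss x i k i≢k x∈i x∈k) (ℕ.≤-trans (ℕ.≤-reflexive (partition x)) (bit≤1 _))))
    ... | true  | false = ≡.refl
    ... | false | _     = ≡.refl

  Partition⇒cover : ∀ {m j} (Ss : Vec (Subset m) j) → Partition Ss → ⋃ (toList Ss) ≡ full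
  Partition⇒cover Ss partition = hasLetter-ext _ _ λ x → begin
    hasLetter (⋃ (toList Ss)) x     ≡⟨ hasLetter-⋃ Ss x ⟩
    anyHasLetter Ss x               ≡⟨ anyHasLetter≡nonzero Ss x ⟩
    nonzero (coverCount Ss x)       ≡⟨ cong nonzero (partition x) ⟩
    nonzero (bit (inRange _ x))     ≡⟨ nonzero-bit _ ⟩
    hasLetter full x                ∎
    where open ≡-Reasoning

  odd⇒nonEmpty : ∀ {m} (S : Subset m) → ∣ S ∣ % 2 ≡ 1 → nonEmpty S ≡ true
  odd⇒nonEmpty S odd with nonEmpty S in nonempty
  ... | true  = ≡.refl
  ... | false with () ← ≡.trans (≡.sym (cong (_% 2) (empty⇒∣∣≡0 S nonempty))) odd

  _⊑dropMax_ : ∀ {m j} → Vec (Subset m) j → Vec (Subset m) j → Set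
  _⊑dropMax_ = Pointwise (λ R S → R ⊑ dropMax S)

  module _ {m : ℕ} where

    AllNonEmpty : ∀ {j} → Vec (Subset m) j → Set
    AllNonEmpty Ss = ∀ i → nonEmpty (lookup Ss i) ≡ true

    odd⇒AllNonEmpty : ∀ {j} (Ss : Vec (Subset m) j) → (∀ i → ∣ lookup Ss i ∣ % 2 ≡ 1) → AllNonEmpty Ss
    odd⇒AllNonEmpty Ss odd i = odd⇒nonEmpty (lookup Ss i) (odd i)

    coverCount-letters : ∀ {j} (ws : Vec Word j) → All (Distinct m) (toList ws) →
                         ∀ x → coverCount (Vec.map (letters m) ws) x ≡ occSum ws x
    coverCount-letters []       _                   x = ≡.refl
    coverCount-letters (w ∷ ws) (distinct ∷ distincts) x =
      cong₂ _+_ (bit-hasLetter-letters m w distinct x) (coverCount-letters ws distincts x)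

    wordOfs-letters : ∀ {j} (ws : Vec Word j) → All (Distinct m) (toList ws) → All Unimodal (toList ws) →
                      zipWith wordOf (Vec.map (letters m) ws) (Vec.map (letters m ∘ descent) ws) ≡ ws
    wordOfs-letters []       _                      _                = ≡.refl
    wordOfs-letters (w ∷ ws) (distinct ∷ distincts) (uni ∷ unis) =
      cong₂ _∷_ (wordOf-letters distinct uni) (wordOfs-letters ws distincts unis)

    letters-descent⊑dropMax-letters : ∀ {j} (ws : Vec Word j) → All (Distinct m) (toList ws) → All Unimodal (toList ws) →
                                      Vec.map (letters m ∘ descent) ws ⊑dropMax Vec.map (letters m) ws
    letters-descent⊑dropMax-letters []       _                      _            = []
    letters-descent⊑dropMax-letters (w ∷ ws) (distinct ∷ distincts) (uni ∷ unis) =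
      letters-descent⊑dropMax distinct uni ∷ letters-descent⊑dropMax-letters ws distincts unis

    letters-wordOfs : ∀ {j} (Ss Rs : Vec (Subset m) j) → AllNonEmpty Ss → Rs ⊑dropMax Ss →
                      Vec.map (letters m) (zipWith wordOf Ss Rs) ≡ Ss
    letters-wordOfs []       []       _        []           = ≡.refl
    letters-wordOfs (S ∷ Ss) (R ∷ Rs) nonempty (R⊑ ∷ Rs⊑) =
      cong₂ _∷_ (WordOf.letters-wordOf S R (nonempty zero) R⊑) (letters-wordOfs Ss Rs (nonempty ∘ suc) Rs⊑)

    letters-descent-wordOfs : ∀ {j} (Ss Rs : Vec (Subset m) j) → AllNonEmpty Ss → Rs ⊑dropMax Ss →
                              Vec.map (letters m ∘ descent) (zipWith wordOf Ss Rs) ≡ Rs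
    letters-descent-wordOfs []       []       _        []           = ≡.refl
    letters-descent-wordOfs (S ∷ Ss) (R ∷ Rs) nonempty (R⊑ ∷ Rs⊑) =
      cong₂ _∷_ (WordOf.letters-descent-wordOf S R (nonempty zero) R⊑) (letters-descent-wordOfs Ss Rs (nonempty ∘ suc) Rs⊑)

    occSum-wordOfs : ∀ {j} (Ss Rs : Vec (Subset m) j) → AllNonEmpty Ss → Rs ⊑dropMax Ss →
                     ∀ x → occSum (zipWith wordOf Ss Rs) x ≡ coverCount Ss x
    occSum-wordOfs []       []       _        []           x = ≡.refl
    occSum-wordOfs (S ∷ Ss) (R ∷ Rs) nonempty (R⊑ ∷ Rs⊑) x =
      cong₂ _+_ (WordOf.occ-wordOf S R (nonempty zero) R⊑ x) (occSum-wordOfs Ss Rs (nonempty ∘ suc) Rs⊑ x)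

    wordOfs-oddUnimodal : ∀ {j} (Ss Rs : Vec (Subset m) j) → (∀ i → ∣ lookup Ss i ∣ % 2 ≡ 1) → Rs ⊑dropMax Ss →
                          All OddUnimodal (toList (zipWith wordOf Ss Rs))
    wordOfs-oddUnimodal []       []       _   []           = []
    wordOfs-oddUnimodal (S ∷ Ss) (R ∷ Rs) odd (R⊑ ∷ Rs⊑) =
      (wordOf-unimodal , ≡.trans (cong (_% 2) length-wordOf) (odd zero)) ∷ wordOfs-oddUnimodal Ss Rs (odd ∘ suc) Rs⊑
      where open WordOf S R (odd⇒nonEmpty S (odd zero)) R⊑

  record Labelling (m j : ℕ) : Set where
    constructor labelling
    field
      words        : Vec Word j
      .oddUnimodal : All OddUnimodal (toList words)
      .partition   : concat (toList words) ↭ range m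

  record DescentSets {m j} (Ss : Vec (Subset m) j) : Set where
    constructor descentSets
    field
      sets      : Vec (Subset m) j
      .⊑dropMax : sets ⊑dropMax Ss

  module _ {m j : ℕ} where

    private
      distincts : (ws : Vec Word j) → concat (toList ws) ↭ range m → All (Distinct m) (toList ws)
      distincts ws ws↭ = occSum⇒Distinct ws (ℕ.≤-reflexive ∘ concat↭range⇒occSum ws ws↭)

      letters-Partition : (ws : Vec Word j) → concat (toList ws) ↭ range m → Partition (Vec.map (letters m) ws)
      letters-Partition ws ws↭ x = ≡.trans (coverCount-letters ws (distincts ws ws↭) x) (concat↭range⇒occSum ws ws↭ x)

      letters-odd : (ws : Vec Word j) → All OddUnimodal (toList ws) → concat (toList ws) ↭ range m →
                    ∀ i → ∣ lookup (Vec.map (letters m) ws) i ∣ % 2 ≡ 1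
      letters-odd ws oddUnis ws↭ i rewrite Vec.lookup-map i (letters m) ws =
        ≡.trans (cong (_% 2) (∣letters∣≡length (lookup⁺ (toList⁻ (distincts ws ws↭)) i) (proj₁ oddUni))) (proj₂ oddUni)
        where oddUni = lookup⁺ (toList⁻ oddUnis) i

      wordOfs↭range : (Ss Rs : Vec (Subset m) j) → (∀ i → ∣ lookup Ss i ∣ % 2 ≡ 1) →
                      (∀ i k → i ≢ k → lookup Ss i ∩ lookup Ss k ≡ ∅) → ⋃ (toList Ss) ≡ full → Rs ⊑dropMax Ss →
                      concat (toList (zipWith wordOf Ss Rs)) ↭ range m
      wordOfs↭range Ss Rs odd disjoint cover Rs⊑ = occ⇒↭ _ _ λ x → begin
        occ x (concat (toList (zipWith wordOf Ss Rs)))  ≡⟨ occ-concat (zipWith wordOf Ss Rs) x ⟩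
        occSum (zipWith wordOf Ss Rs) x                ≡⟨ occSum-wordOfs Ss Rs (odd⇒AllNonEmpty Ss odd) Rs⊑ x ⟩
        coverCount Ss x                                ≡⟨ disjoint-cover⇒Partition Ss disjoint cover x ⟩
        bit (inRange m x)                              ≡⟨ occ-range m x ⟨
        occ x (range m)                                ∎
        where open ≡-Reasoning

      same-composition : ∀ {Ss Ss′ Rs Rs′ : Vec (Subset m) j} .{o d c s o′ d′ c′ s′} → Ss ≡ Ss′ → Rs ≡ Rs′ →
                         _≡_ {A = Σ (OddComp m j) (DescentSets ∘ OddComp.blocks)}
                             (oc Ss o d c , descentSets Rs s) (oc Ss′ o′ d′ c′ , descentSets Rs′ s′)
      same-composition ≡.refl ≡.refl = ≡.refl

      same-labelling : ∀ {ws ws′ : Vec Word j} .{u p u′ p′} → ws ≡ ws′ →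
                       _≡_ {A = Labelling m j} (labelling ws u p) (labelling ws′ u′ p′)
      same-labelling ≡.refl = ≡.refl

    labelling↔composition : Labelling m j ↔ Σ (OddComp m j) (DescentSets ∘ OddComp.blocks)
    labelling↔composition = mk↔ₛ′ to from to-from from-to
      where
      to : Labelling m j → Σ (OddComp m j) (DescentSets ∘ OddComp.blocks)
      to (labelling ws oddUnis ws↭) =
        oc (Vec.map (letters m) ws) (letters-odd ws oddUnis ws↭)
           (Partition⇒disjoint (Vec.map (letters m) ws) (letters-Partition ws ws↭))
           (Partition⇒cover (Vec.map (letters m) ws) (letters-Partition ws ws↭)) ,
        descentSets (Vec.map (letters m ∘ descent) ws)
                    (letters-descent⊑dropMax-letters ws (distincts ws ws↭) (All.map proj₁ oddUnis))

      from : Σ (OddComp m j) (DescentSets ∘ OddComp.blocks) → Labelling m j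
      from (oc Ss odd disjoint cover , descentSets Rs Rs⊑) =
        labelling (zipWith wordOf Ss Rs) (wordOfs-oddUnimodal Ss Rs odd Rs⊑) (wordOfs↭range Ss Rs odd disjoint cover Rs⊑)

      to-from : ∀ c → to (from c) ≡ c
      to-from (oc Ss odd disjoint cover , descentSets Rs Rs⊑) = same-composition
        (recompute (Vec.≡-dec (Vec.≡-dec Bool._≟_) _ _) (letters-wordOfs Ss Rs (odd⇒AllNonEmpty Ss odd) Rs⊑))
        (recompute (Vec.≡-dec (Vec.≡-dec Bool._≟_) _ _) (letters-descent-wordOfs Ss Rs (odd⇒AllNonEmpty Ss odd) Rs⊑))

      from-to : ∀ l → from (to l) ≡ l
      from-to (labelling ws oddUnis ws↭) = same-labelling
        (recompute (Vec.≡-dec (List.≡-dec ℕ._≟_) _ _) (wordOfs-letters ws (distincts ws ws↭) (All.map proj₁ oddUnis)))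

  record SubsetOf {k} (D : Subset k) : Set where
    constructor subsetOf
    field
      subset : Subset k
      .⊑D    : subset ⊑ D

  subsetOf-enumeration : ∀ {k} (D : Subset k) → Enumeration (SubsetOf D)
  subsetOf-enumeration []          =
    via ⊤-enumeration (mk↔ₛ′ (const (subsetOf [] [])) (const tt) (λ { (subsetOf [] _) → ≡.refl }) (λ _ → ≡.refl))
  subsetOf-enumeration (true  ∷ D) = via (×-enumeration Bool-enumeration (subsetOf-enumeration D))
    (mk↔ₛ′ (λ (b , subsetOf R R⊑D) → subsetOf (b ∷ R) (Bool.≤-maximum b ∷ R⊑D))
           (λ { (subsetOf (b ∷ R) bR⊑) → b , subsetOf R (Pointwise.tail bR⊑) })
           (λ { (subsetOf (b ∷ R) _) → ≡.refl }) (λ { (b , subsetOf R _) → ≡.refl }))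
  subsetOf-enumeration (false ∷ D) = via (subsetOf-enumeration D) (mk↔ₛ′ to from to-from (λ _ → ≡.refl))
    where
    to : SubsetOf D → SubsetOf (false ∷ D)
    to (subsetOf R R⊑D) = subsetOf (false ∷ R) (b≤b ∷ R⊑D)
    t≰f : ¬ true Bool.≤ false
    t≰f ()
    from : SubsetOf (false ∷ D) → SubsetOf D
    from (subsetOf (false ∷ R) bR⊑) = subsetOf R (Pointwise.tail bR⊑)
    from (subsetOf (true  ∷ R) bR⊑) = ⊥-elim-irr (t≰f (Pointwise.head bR⊑))
    to-from : ∀ R → to (from R) ≡ R
    to-from (subsetOf (false ∷ R) _)   = ≡.refl
    to-from (subsetOf (true  ∷ R) bR⊑) = ⊥-elim-irr (t≰f (Pointwise.head bR⊑))

  size-subsetOf-enumeration : ∀ {k} (D : Subset k) → size (subsetOf-enumeration D) ≡ 2 ^ ∣ D ∣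
  size-subsetOf-enumeration []          = ≡.refl
  size-subsetOf-enumeration (true  ∷ D) =
    ≡.trans (size-× Bool-enumeration (subsetOf-enumeration D)) (cong (2 *_) (size-subsetOf-enumeration D))
  size-subsetOf-enumeration (false ∷ D) = size-subsetOf-enumeration D

  descentSets-enumeration : ∀ {m j} (Ss : Vec (Subset m) j) → Enumeration (DescentSets Ss)
  descentSets-enumeration []       =
    via ⊤-enumeration (mk↔ₛ′ (const (descentSets [] [])) (const tt) (λ { (descentSets [] _) → ≡.refl }) (λ _ → ≡.refl))
  descentSets-enumeration (S ∷ Ss) = via (×-enumeration (subsetOf-enumeration (dropMax S)) (descentSets-enumeration Ss))
    (mk↔ₛ′ (λ (subsetOf R R⊑ , descentSets Rs Rs⊑) → descentSets (R ∷ Rs) (R⊑ ∷ Rs⊑))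
           (λ { (descentSets (R ∷ Rs) ⊑s) → subsetOf R (Pointwise.head ⊑s) , descentSets Rs (Pointwise.tail ⊑s) })
           (λ { (descentSets (R ∷ Rs) _) → ≡.refl }) (λ { (subsetOf R _ , descentSets Rs _) → ≡.refl }))

  size-descentSets-enumeration : ∀ {m j} (Ss : Vec (Subset m) j) →
                                 size (descentSets-enumeration Ss) ≡ 2 ^ Vec.sum (Vec.map (∣_∣ ∘ dropMax) Ss)
  size-descentSets-enumeration []       = ≡.refl
  size-descentSets-enumeration (S ∷ Ss) = begin
    size (×-enumeration (subsetOf-enumeration (dropMax S)) (descentSets-enumeration Ss))
      ≡⟨ size-× (subsetOf-enumeration (dropMax S)) (descentSets-enumeration Ss) ⟩
    size (subsetOf-enumeration (dropMax S)) * size (descentSets-enumeration Ss)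
      ≡⟨ cong₂ _*_ (size-subsetOf-enumeration (dropMax S)) (size-descentSets-enumeration Ss) ⟩
    2 ^ ∣ dropMax S ∣ * 2 ^ Vec.sum (Vec.map (∣_∣ ∘ dropMax) Ss)
      ≡⟨ ℕ.^-distribˡ-+-* 2 ∣ dropMax S ∣ _ ⟨
    2 ^ Vec.sum (Vec.map (∣_∣ ∘ dropMax) (S ∷ Ss)) ∎
    where open ≡-Reasoning

  sum-∣dropMax∣+j : ∀ {m j} (Ss : Vec (Subset m) j) → AllNonEmpty Ss →
                    Vec.sum (Vec.map (∣_∣ ∘ dropMax) Ss) + j ≡ Vec.sum (Vec.map ∣_∣ Ss)
  sum-∣dropMax∣+j []               _        = ≡.refl
  sum-∣dropMax∣+j {j = suc j} (S ∷ Ss) nonempty = begin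
    ∣ dropMax S ∣ + Vec.sum (Vec.map (∣_∣ ∘ dropMax) Ss) + suc j   ≡⟨ ℕ.+-suc _ j ⟩
    suc (∣ dropMax S ∣ + Vec.sum (Vec.map (∣_∣ ∘ dropMax) Ss) + j) ≡⟨ cong suc (ℕ.+-assoc ∣ dropMax S ∣ _ j) ⟩
    suc ∣ dropMax S ∣ + (Vec.sum (Vec.map (∣_∣ ∘ dropMax) Ss) + j)
      ≡⟨ cong₂ _+_ (∣dropMax∣ S (nonempty zero)) (sum-∣dropMax∣+j Ss (nonempty ∘ suc)) ⟩
    ∣ S ∣ + Vec.sum (Vec.map ∣_∣ Ss)                               ∎
    where open ≡-Reasoning

  occ-concat-ascending : ∀ {m j} (Ss : Vec (Subset m) j) x → occ x (concat (toList (Vec.map ascending Ss))) ≡ coverCount Ss x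
  occ-concat-ascending []       x = ≡.refl
  occ-concat-ascending (S ∷ Ss) x =
    ≡.trans (occ-++ x (ascending S) _) (cong₂ _+_ (occ-ascending S x) (occ-concat-ascending Ss x))

  length-concat-ascending : ∀ {m j} (Ss : Vec (Subset m) j) → List.length (concat (toList (Vec.map ascending Ss))) ≡ Vec.sum (Vec.map ∣_∣ Ss)
  length-concat-ascending []       = ≡.refl
  length-concat-ascending (S ∷ Ss) =
    ≡.trans (List.length-++ (ascending S)) (cong₂ _+_ (length-ascending S) (length-concat-ascending Ss))

  -- Listing every block in increasing order gives a permutation of [m].
  sum-∣∣≡m : ∀ {m j} (Ss : Vec (Subset m) j) → Partition Ss → Vec.sum (Vec.map ∣_∣ Ss) ≡ m
  sum-∣∣≡m {m} Ss partition = begin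
    Vec.sum (Vec.map ∣_∣ Ss)                            ≡⟨ length-concat-ascending Ss ⟨
    List.length (concat (toList (Vec.map ascending Ss))) ≡⟨ ↭-length (occ⇒↭ (concat (toList (Vec.map ascending Ss))) (range m) occ≡) ⟩
    List.length (range m)                               ≡⟨ List.length-map suc (List.upTo m) ⟩
    List.length (List.upTo m)                           ≡⟨ List.length-upTo m ⟩
    m                                                   ∎
    where
    open ≡-Reasoning
    occ≡ : ∀ x → occ x (concat (toList (Vec.map ascending Ss))) ≡ occ x (range m)
    occ≡ x = ≡.trans (occ-concat-ascending Ss x) (≡.trans (partition x) (≡.sym (occ-range m x)))

  sum-∣dropMax∣≡m∸j : ∀ {m j} (c : OddComp m j) → Vec.sum (Vec.map (∣_∣ ∘ dropMax) (OddComp.blocks c)) ≡ m ∸ j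
  sum-∣dropMax∣≡m∸j {m} {j} (oc Ss odd disjoint cover) = recompute (_ ℕ.≟ _) (begin
    Vec.sum (Vec.map (∣_∣ ∘ dropMax) Ss)              ≡⟨ ℕ.m+n∸n≡m _ j ⟨
    Vec.sum (Vec.map (∣_∣ ∘ dropMax) Ss) + j ∸ j      ≡⟨ cong (_∸ j) (sum-∣dropMax∣+j Ss (odd⇒AllNonEmpty Ss odd)) ⟩
    Vec.sum (Vec.map ∣_∣ Ss) ∸ j                      ≡⟨ cong (_∸ j) (sum-∣∣≡m Ss (disjoint-cover⇒Partition Ss disjoint cover)) ⟩
    m ∸ j                                             ∎)
    where open ≡-Reasoning

  labelling-enumeration : ∀ {m j} → Enumeration (OddComp m j) → Enumeration (Labelling m j)
  labelling-enumeration E =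
    via (Σ-enumeration E (descentSets-enumeration ∘ OddComp.blocks)) (↔-sym labelling↔composition)

  size-labelling-enumeration : ∀ {m j} (E : Enumeration (OddComp m j)) →
                               size (labelling-enumeration E) ≡ size E * 2 ^ (m ∸ j)
  size-labelling-enumeration E = size-Σ E (descentSets-enumeration ∘ OddComp.blocks) λ c →
    ≡.trans (size-descentSets-enumeration (OddComp.blocks c)) (cong (2 ^_) (sum-∣dropMax∣≡m∸j c))


module LabelledTrees where

  open import Defs
  open Enumerations
  open BinaryShapes
  open Labellings using (Labelling; labelling)
  open import Data.Nat as ℕ using (ℕ; suc; _+_; _*_; _≤_; _<_; s≤s; z≤n; _%_; _/_)
  import Data.Nat.Properties as ℕ
  open import Data.Nat.DivMod using (m*n/n≡m)
  open import Data.Nat.Tactic.RingSolver using (solve-∀)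
  open import Data.Fin using (Fin; toℕ; fromℕ<)
  import Data.Fin.Properties as Fin
  open import Data.List as List using (List; []; _∷_; _++_; length; concat)
  import Data.List.Properties as List
  open import Data.List.Relation.Unary.All using (All; []; _∷_)
  open import Data.List.Relation.Binary.Permutation.Propositional using (_↭_)
  open import Data.List.Relation.Binary.Permutation.Propositional.Properties using (↭-length)
  open import Data.Vec as Vec using (Vec; []; _∷_; toList; take; drop)
  import Data.Vec.Properties as Vec
  open import Data.Product using (Σ; _,_; proj₁; proj₂)
  open import Function using (_∘_; _↔_; Inverse; mk↔ₛ′)
  open import Relation.Binary.PropositionalEquality
    using (_≡_; refl; sym; trans; cong; cong₂; subst; module ≡-Reasoning)
  open import Relation.Nullary.Decidable using (recompute)

  shapeOf : Tree → Shape
  shapeOf (leaf _)     = leaf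
  shapeOf (node _ l r) = node (shapeOf l) (shapeOf r)

  labelVector : (t : Tree) → Vec Word (nodes (shapeOf t))
  labelVector (leaf w)     = w ∷ []
  labelVector (node w l r) = w ∷ (labelVector l Vec.++ labelVector r)

  build : (s : Shape) → Vec Word (nodes s) → Tree
  build leaf       (w ∷ [])  = leaf w
  build (node a b) (w ∷ ws) = node w (build a (take (nodes a) ws)) (build b (drop (nodes a) ws))

  LabelledShape : Set
  LabelledShape = Σ Shape (Vec Word ∘ nodes)

  shape-build : ∀ s ws → _≡_ {A = LabelledShape} (shapeOf (build s ws) , labelVector (build s ws)) (s , ws)
  shape-build leaf       (w ∷ [])  = refl
  shape-build (node a b) (w ∷ ws) = trans
    (join (shape-build a (take (nodes a) ws)) (shape-build b (drop (nodes a) ws)))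
    (cong (λ ws′ → node a b , w ∷ ws′) (Vec.take++drop≡id (nodes a) ws))
    where
    join : ∀ {x y : LabelledShape} {x′ y′ : LabelledShape} → x ≡ x′ → y ≡ y′ →
           _≡_ {A = LabelledShape} (node (proj₁ x) (proj₁ y) , w ∷ (proj₂ x Vec.++ proj₂ y))
                                   (node (proj₁ x′) (proj₁ y′) , w ∷ (proj₂ x′ Vec.++ proj₂ y′))
    join refl refl = refl

  build-shape : ∀ t → build (shapeOf t) (labelVector t) ≡ t
  build-shape (leaf w)     = refl
  build-shape (node w l r) = cong₂ (node w)
    (trans (cong (build (shapeOf l)) take-++) (build-shape l))
    (trans (cong (build (shapeOf r)) drop-++) (build-shape r))
    where
    split = Vec.take++drop≡id (nodes (shapeOf l)) (labelVector l Vec.++ labelVector r)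
    take-++ = Vec.++-injectiveˡ _ (labelVector l) split
    drop-++ = Vec.++-injectiveʳ _ (labelVector l) split

  toList-labelVector : ∀ t → toList (labelVector t) ≡ labels t
  toList-labelVector (leaf w)     = refl
  toList-labelVector (node w l r) = cong (w ∷_)
    (trans (Vec.toList-++ (labelVector l) (labelVector r)) (cong₂ _++_ (toList-labelVector l) (toList-labelVector r)))

  labels-build : ∀ s ws → labels (build s ws) ≡ toList ws
  labels-build s ws =
    trans (sym (toList-labelVector (build s ws))) (cong (λ (p : LabelledShape) → toList (proj₂ p)) (shape-build s ws))

  h≡internal : ∀ t → h t ≡ internal (shapeOf t)
  h≡internal t = trans (cong (_/ 2) (trans (edges≡ t) (ℕ.*-comm 2 (internal (shapeOf t))))) (m*n/n≡m (internal (shapeOf t)) 2)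
    where
    edges≡ : ∀ t → edges t ≡ 2 * internal (shapeOf t)
    edges≡ (leaf _)     = refl
    edges≡ (node _ l r) = trans (cong₂ (λ x y → 2 + x + y) (edges≡ l) (edges≡ r)) (even+even (internal (shapeOf l)) (internal (shapeOf r)))
      where
      even+even : ∀ x y → 2 + 2 * x + 2 * y ≡ 2 * suc (x + y)
      even+even = solve-∀

  -- Every label is nonempty, so a tree on [2n+1] has at most 2n+1 nodes.
  internal<suc : ∀ n t → All OddUnimodal (labels t) → concat (labels t) ↭ range (2 * n + 1) → internal (shapeOf t) < suc n
  internal<suc n t oddUnis partition = s≤s (ℕ.*-cancelˡ-≤ 2 (ℕ.+-cancelʳ-≤ 1 (2 * internal (shapeOf t)) (2 * n) (begin
    2 * internal (shapeOf t) + 1   ≡⟨ ℕ.+-comm _ 1 ⟩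
    suc (2 * internal (shapeOf t)) ≡⟨ nodes≡ (shapeOf t) ⟨
    nodes (shapeOf t)              ≡⟨ Vec.length-toList (labelVector t) ⟨
    length (toList (labelVector t)) ≡⟨ cong length (toList-labelVector t) ⟩
    length (labels t)            ≤⟨ length≤length-concat (labels t) oddUnis ⟩
    length (concat (labels t))   ≡⟨ ↭-length partition ⟩
    length (range (2 * n + 1))   ≡⟨ List.length-map suc (List.upTo (2 * n + 1)) ⟩
    length (List.upTo (2 * n + 1)) ≡⟨ List.length-upTo (2 * n + 1) ⟩
    2 * n + 1                    ∎)))
    where
    open ℕ.≤-Reasoning
    length≤length-concat : ∀ ws → All OddUnimodal ws → length ws ≤ length (concat ws)
    length≤length-concat []       []                  = z≤n
    length≤length-concat (w ∷ ws) ((_ , odd) ∷ oddUnis) rewrite List.length-++ w {concat ws} =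
      ℕ.+-mono-≤ (nonempty w odd) (length≤length-concat ws oddUnis)
      where
      nonempty : ∀ (w : Word) → length w % 2 ≡ 1 → 1 ≤ length w
      nonempty (_ ∷ _) _ = s≤s z≤n

  module _ (n : ℕ) where

    Decomposition : Set
    Decomposition = Σ (Fin (suc n)) λ k → Σ (Shapes (toℕ k)) λ s → Labelling (2 * n + 1) (nodes (tree s))

    private
      same-lb : ∀ {t t′} .{u p u′ p′} → t ≡ t′ → lb {2 * n + 1} t u p ≡ lb t′ u′ p′
      same-lb refl = refl

      same-decomposition : ∀ {k k′ : Fin (suc n)} {x x′ : LabelledShape} → k ≡ k′ → x ≡ x′ →
                           .(p : internal (proj₁ x) ≡ toℕ k) .(p′ : internal (proj₁ x′) ≡ toℕ k′) → ∀ .{u q u′ q′} →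
                           _≡_ {A = Decomposition} (k , shape (proj₁ x) p , labelling (proj₂ x) u q)
                                                   (k′ , shape (proj₁ x′) p′ , labelling (proj₂ x′) u′ q′)
      same-decomposition refl refl _ _ = refl

    decompose : LB (2 * n + 1) ↔ Decomposition
    decompose = mk↔ₛ′ to from to-from from-to
      where
      to : LB (2 * n + 1) → Decomposition
      to (lb t oddUnis partition) =
        fromℕ< (internal<suc n t oddUnis partition) ,
        shape (shapeOf t) (sym (Fin.toℕ-fromℕ< _)) ,
        labelling (labelVector t) (subst (All OddUnimodal) (sym (toList-labelVector t)) oddUnis)
                                  (subst (λ ls → concat ls ↭ range (2 * n + 1)) (sym (toList-labelVector t)) partition)

      from : Decomposition → LB (2 * n + 1)
      from (k , shape s p , labelling ws oddUnis partition) =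
        lb (build s ws) (subst (All OddUnimodal) (sym (labels-build s ws)) oddUnis)
                        (subst (λ ls → concat ls ↭ range (2 * n + 1)) (sym (labels-build s ws)) partition)

      to-from : ∀ d → to (from d) ≡ d
      to-from (k , shape s p , labelling ws _ _) = same-decomposition
        (trans (Fin.fromℕ<-cong _ _ (trans (cong (internal ∘ proj₁) (shape-build s ws)) (recompute (_ ℕ.≟ _) p)) _ _)
               (Fin.fromℕ<-toℕ k (Fin.toℕ<n k)))
        (shape-build s ws) _ p

      from-to : ∀ t → from (to t) ≡ t
      from-to (lb t _ _) = same-lb (build-shape t)

    h-decompose⁻¹ : ∀ k s l → h (LB.tree (Inverse.from decompose (k , s , l))) ≡ toℕ k
    h-decompose⁻¹ k (shape s p) (labelling ws _ _) =
      trans (h≡internal (build s ws)) (trans (cong (internal ∘ proj₁) (shape-build s ws)) (recompute (_ ℕ.≟ _) p))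


open import Defs
open import Data.Nat as ℕ using (ℕ; zero; suc; _+_; _*_; _∸_; _^_; _≤_)
import Data.Nat.Properties as ℕ
open import Data.Integer as ℤ using (ℤ; +_) renaming (_+_ to _+ℤ_; _*_ to _*ℤ_)
import Data.Integer.Properties as ℤ
open import Data.Fin using (Fin; toℕ)
open import Data.Fin.Properties using (toℕ≤pred[n])
open import Data.Product using (Σ; _,_)
open import Function using (_∘_; const; _↔_; Inverse)
open import Function.Properties.Inverse using (↔-sym)
open import Relation.Binary.PropositionalEquality
  using (_≡_; refl; sym; trans; cong; cong₂; subst; module ≡-Reasoning)

open Enumerations
open BinaryShapes
open Labellings using (Labelling; labelling-enumeration; size-labelling-enumeration)
open LabelledTrees

∑≡∑≤ : ∀ n (f : ℕ → ℤ) → ∑ (suc n) (f ∘ toℕ) ≡ ∑≤ n f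
∑≡∑≤ zero    f = ℤ.+-identityʳ (f 0)
∑≡∑≤ (suc n) f = begin
  f 0 +ℤ ∑ (suc n) (f ∘ suc ∘ toℕ)   ≡⟨ cong (f 0 +ℤ_) (∑≡∑≤ n (f ∘ suc)) ⟩
  f 0 +ℤ ∑≤ n (f ∘ suc)             ≡⟨ ∑≤-suc n f ⟨
  ∑≤ (suc n) f                      ∎
  where
  open ≡-Reasoning
  ∑≤-suc : ∀ n (f : ℕ → ℤ) → ∑≤ (suc n) f ≡ f 0 +ℤ ∑≤ n (f ∘ suc)
  ∑≤-suc zero    f = refl
  ∑≤-suc (suc n) f = trans (cong (_+ℤ f (suc (suc n))) (∑≤-suc n f)) (ℤ.+-assoc (f 0) _ _)

size-subst : ∀ {A : ℕ → Set} {i j} (i≡j : i ≡ j) (E : Enumeration (A i)) → size (subst (Enumeration ∘ A) i≡j E) ≡ size E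
size-subst refl E = refl

module Counting (n : ℕ) (O : ℕ → ℕ) (enumO : (k : ℕ) → k ≤ n → Fin (O k) ↔ OddComp (2 * n + 1) (2 * k + 1)) where

  Fibre : Fin (suc n) → Set
  Fibre k = Σ (Shapes (toℕ k)) λ s → Labelling (2 * n + 1) (nodes (tree s))

  nodes≡2k+1 : ∀ {k} (s : Shapes k) → nodes (tree s) ≡ 2 * k + 1
  nodes≡2k+1 {k} s = trans (nodes≡ (tree s)) (trans (cong (suc ∘ (2 *_)) (internal-tree s)) (ℕ.+-comm 1 (2 * k)))

  oddComp-enumeration : (k : Fin (suc n)) → Enumeration (OddComp (2 * n + 1) (2 * toℕ k + 1))
  oddComp-enumeration k = enumeration (O (toℕ k)) (enumO (toℕ k) (toℕ≤pred[n] k))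

  labellings-enumeration : (k : Fin (suc n)) (s : Shapes (toℕ k)) → Enumeration (Labelling (2 * n + 1) (nodes (tree s)))
  labellings-enumeration k s =
    subst (Enumeration ∘ Labelling (2 * n + 1)) (sym (nodes≡2k+1 s)) (labelling-enumeration (oddComp-enumeration k))

  fibre-enumeration : (k : Fin (suc n)) → Enumeration (Fibre k)
  fibre-enumeration k = Σ-enumeration (shapes-enumeration (toℕ k)) (labellings-enumeration k)

  size-fibre-enumeration : (k : Fin (suc n)) →
                           size (fibre-enumeration k) ≡ O (toℕ k) * 2 ^ (2 * n ∸ 2 * toℕ k) * catalan (toℕ k)
  size-fibre-enumeration k = begin
    size (fibre-enumeration k)                          ≡⟨ size-Σ (shapes-enumeration k′) (labellings-enumeration k) size-labellings ⟩
    #shapes k′ * (O k′ * 2 ^ (2 * n ∸ 2 * k′))           ≡⟨ cong (_* (O k′ * 2 ^ (2 * n ∸ 2 * k′))) (#shapes≡catalan k′) ⟩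
    catalan k′ * (O k′ * 2 ^ (2 * n ∸ 2 * k′))           ≡⟨ ℕ.*-comm (catalan k′) _ ⟩
    O k′ * 2 ^ (2 * n ∸ 2 * k′) * catalan k′             ∎
    where
    open ≡-Reasoning
    k′ = toℕ k
    size-labellings : ∀ s → size (labellings-enumeration k s) ≡ O k′ * 2 ^ (2 * n ∸ 2 * k′)
    size-labellings s = trans (size-subst {A = Labelling (2 * n + 1)} (sym (nodes≡2k+1 s)) _)
      (trans (size-labelling-enumeration (oddComp-enumeration k))
             (cong (λ e → O k′ * 2 ^ e) (cong₂ _∸_ (ℕ.+-comm (2 * n) 1) (ℕ.+-comm (2 * k′) 1))))

  term : ℕ → ℤ
  term k = sign k *ℤ + (O k * 2 ^ (2 * n ∸ 2 * k) * catalan k)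

  -- All trees of a fibre have toℕ k internal nodes, hence the same sign.
  sumOver-fibre : (k : Fin (suc n)) →
                  sumOver (fibre-enumeration k) (λ (s , l) → sign (h (LB.tree (Inverse.from (decompose n) (k , s , l)))))
                  ≡ term (toℕ k)
  sumOver-fibre k = begin
    sumOver (fibre-enumeration k) (λ (s , l) → sign (h (LB.tree (Inverse.from (decompose n) (k , s , l)))))
      ≡⟨ sumOver-cong (fibre-enumeration k) (λ (s , l) → cong sign (h-decompose⁻¹ n k s l)) ⟩
    sumOver (fibre-enumeration k) (const (sign k′))
      ≡⟨ sumOver-const (fibre-enumeration k) (sign k′) ⟩
    + size (fibre-enumeration k) *ℤ sign k′
      ≡⟨ cong (λ c → + c *ℤ sign k′) (size-fibre-enumeration k) ⟩
    + (O k′ * 2 ^ (2 * n ∸ 2 * k′) * catalan k′) *ℤ sign k′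
      ≡⟨ ℤ.*-comm _ (sign k′) ⟩
    term k′ ∎
    where
    open ≡-Reasoning
    k′ = toℕ k

open Counting

lemma2p2 : (n : ℕ) (E : ℕ) (enumLB : Fin E ↔ LB (2 * n + 1))
    (O : ℕ → ℕ) (enumO : (k : ℕ) → k ≤ n → Fin (O k) ↔ OddComp (2 * n + 1) (2 * k + 1)) →
    ∑ E (λ i → sign (h (LB.tree (Inverse.to enumLB i))))
      ≡ ∑≤ n (λ k → sign k *ℤ + (O k * 2 ^ (2 * n ∸ 2 * k) * catalan k))
lemma2p2 n E enumLB O enumO = begin
  sumOver (enumeration E enumLB) signOfH
    ≡⟨ sumOver-unique (enumeration E enumLB) (via decomposition-enumeration (↔-sym (decompose n))) signOfH ⟩
  sumOver (via decomposition-enumeration (↔-sym (decompose n))) signOfH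
    ≡⟨ sumOver-via decomposition-enumeration (↔-sym (decompose n)) signOfH ⟩
  sumOver decomposition-enumeration (signOfH ∘ Inverse.to (↔-sym (decompose n)))
    ≡⟨ sumOver-ΣFin (suc n) (Fibre n O enumO) (fibre-enumeration n O enumO) (signOfH ∘ Inverse.to (↔-sym (decompose n))) ⟩
  ∑ (suc n) (λ k → sumOver (fibre-enumeration n O enumO k) (λ (s , l) → signOfH (Inverse.from (decompose n) (k , s , l))))
    ≡⟨ ∑-cong (suc n) (sumOver-fibre n O enumO) ⟩
  ∑ (suc n) (term n O enumO ∘ toℕ)
    ≡⟨ ∑≡∑≤ n (term n O enumO) ⟩
  ∑≤ n (term n O enumO) ∎
  where
  open ≡-Reasoning
  decomposition-enumeration : Enumeration (Decomposition n)
  decomposition-enumeration = ΣFin-enumeration (suc n) (Fibre n O enumO) (fibre-enumeration n O enumO)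
  signOfH : LB (2 * n + 1) → ℤ
  signOfH = sign ∘ h ∘ LB.tree
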